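{- Let $m\mid n$ and suppose there is a group divisible triangle design $(V,\mathcal{G},\mathcal{B})$ of order $n$ with groups of dimension $m$ over $\mathbb{F}_2$, where $V=\mathbb{F}_{2^n}$, $\mathcal{G}=\{a\mathbb{F}_{2^m}: a\in\mathbb{F}_{2^n}^*\}$ is the Desarguesian spread, and $\mathcal{B}$ is invariant under the action of $\mathbb{F}_{2^n}^*$ by multiplication. Then $n-m\equiv 0\pmod 6$.
   Context: A triangle is a set $\{\langle a,b\rangle,\langle b,c\rangle,\langle c,a\rangle\}$ of $2$-dimensional $\mathbb{F}_2$-subspaces with $a,b,c$ linearly independent. A group divisible triangle design of order $n$ with groups of dimension $m$ over $\mathbb{F}_q$ is a triple $(V,\mathcal{G},\mathcal{B})$: $V$ an $n$-dimensional $\mathbb{F}_q$-space, $\mathcal{G}$ a set of $m$-dimensional subspaces such that every nonzero vector lies in exactly one, and $\mathcal{B}$ a set of triangles such that every $2$-dimensional subspace either belongs to exactly one triangle of $\mathcal{B}$ and to no group, or to no triangle and to one group. -}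

module Defs where

open import Data.Nat using (ℕ; zero; suc; _^_)
open import Data.Bool using (Bool; true; false; _xor_)
open import Data.Vec using (Vec; replicate; zipWith)
open import Data.Product using (Σ; _×_; _,_; ∃)
open import Data.Sum using (_⊎_)
open import Relation.Binary.PropositionalEquality using (_≡_; _≢_)
open import Relation.Nullary using (¬_)

V : ℕ → Set
V n = Vec Bool n

𝟎 : ∀ {n} → V n
𝟎 = replicate _ false

_⊕_ : ∀ {n} → V n → V n → V n
_⊕_ = zipWith _xor_

_·_ : ∀ {n} → Bool → V n → V n
true  · v = v
false · v = 𝟎

-- A field structure on F₂ⁿ whose addition is the vector addition.
-- Such a field has 2ⁿ elements, i.e. it is (a copy of) F_{2ⁿ}.
record FieldOn (n : ℕ) : Set where
  field
    _⊛_         : V n → V n → V n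
    𝟏           : V n
    ⊛-assoc     : ∀ x y z → (x ⊛ y) ⊛ z ≡ x ⊛ (y ⊛ z)
    ⊛-comm      : ∀ x y → x ⊛ y ≡ y ⊛ x
    ⊛-identityˡ : ∀ x → 𝟏 ⊛ x ≡ x
    ⊛-distribˡ  : ∀ x y z → x ⊛ (y ⊕ z) ≡ (x ⊛ y) ⊕ (x ⊛ z)
    𝟏≢𝟎         : 𝟏 ≢ 𝟎
    ⊛-inverse   : ∀ x → x ≢ 𝟎 → ∃ λ y → x ⊛ y ≡ 𝟏

module _ {n : ℕ} (F : FieldOn n) where
  open FieldOn F

  pow : V n → ℕ → V n
  pow x zero    = 𝟏
  pow x (suc k) = x ⊛ pow x k

  InSubfield : ℕ → V n → Set
  InSubfield m x = pow x (2 ^ m) ≡ x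

  Grp : ℕ → V n → V n → Set
  Grp m a x = ∃ λ y → InSubfield m y × x ≡ a ⊛ y

Sub : ℕ → Set₁
Sub n = V n → Set

_≐_ : ∀ {n} → Sub n → Sub n → Set
L ≐ L' = ∀ x → (L x → L' x) × (L' x → L x)

_⊆_ : ∀ {n} → Sub n → Sub n → Set
L ⊆ L' = ∀ x → L x → L' x

Span2 : ∀ {n} → V n → V n → Sub n
Span2 a b x = x ≡ 𝟎 ⊎ x ≡ a ⊎ x ≡ b ⊎ x ≡ a ⊕ b

Indep2 : ∀ {n} → V n → V n → Set
Indep2 a b = ∀ e₁ e₂ → (e₁ · a) ⊕ (e₂ · b) ≡ 𝟎 → e₁ ≡ false × e₂ ≡ false

Triple : ℕ → Set
Triple n = V n × V n × V n

Indep3 : ∀ {n} → Triple n → Set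
Indep3 (a , b , c) = ∀ e₁ e₂ e₃ → ((e₁ · a) ⊕ (e₂ · b)) ⊕ (e₃ · c) ≡ 𝟎 →
  e₁ ≡ false × e₂ ≡ false × e₃ ≡ false

LineOf : ∀ {n} → Triple n → Sub n → Set
LineOf (a , b , c) L = (L ≐ Span2 a b) ⊎ (L ≐ Span2 b c) ⊎ (L ≐ Span2 c a)

-- equality of triangles as sets of 2-dimensional subspaces
TriEq : ∀ {n} → Triple n → Triple n → Set
TriEq T@(a , b , c) T'@(a' , b' , c') =
  (LineOf T' (Span2 a b) × LineOf T' (Span2 b c) × LineOf T' (Span2 c a)) ×
  (LineOf T (Span2 a' b') × LineOf T (Span2 b' c') × LineOf T (Span2 c' a'))

-- Group divisible triangle design on V = F_{2ⁿ} (field structure F) whose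
-- groups form the Desarguesian spread {a F_{2^m} : a ≠ 0}, with block set B
-- (the set of triangles is { T : B T }), invariant under multiplication by F*.
record IsInvariantDesarguesianGDTD {n : ℕ} (F : FieldOn n) (m : ℕ)
         (B : Triple n → Set) : Set where
  open FieldOn F
  field
    blocks-are-triangles : ∀ T → B T → Indep3 T
    groups-partition :
      ∀ x → x ≢ 𝟎 →
        (∃ λ a → a ≢ 𝟎 × Grp F m a x) ×
        (∀ a a' → a ≢ 𝟎 → a' ≢ 𝟎 → Grp F m a x → Grp F m a' x →
           Grp F m a ≐ Grp F m a')
    lines-covered :
      ∀ u v → Indep2 u v →
        -- exactly one triangle of B, and no group
        (( (∃ λ T → B T × LineOf T (Span2 u v)) ×
           (∀ T T' → B T → B T' → LineOf T (Span2 u v) → LineOf T' (Span2 u v) →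
              TriEq T T') ) ×
         (∀ a → a ≢ 𝟎 → ¬ (Span2 u v ⊆ Grp F m a)))
        ⊎
        -- no triangle of B, and exactly one group
        ((∀ T → B T → ¬ LineOf T (Span2 u v)) ×
         ((∃ λ a → a ≢ 𝟎 × Span2 u v ⊆ Grp F m a) ×
          (∀ a a' → a ≢ 𝟎 → a' ≢ 𝟎 → Span2 u v ⊆ Grp F m a →
             Span2 u v ⊆ Grp F m a' → Grp F m a ≐ Grp F m a')))
    mult-invariant :
      ∀ s → s ≢ 𝟎 → ∀ a b c → B (a , b , c) →
        ∃ λ T' → B T' × TriEq T' (s ⊛ a , s ⊛ b , s ⊛ c)

{-# OPTIONS --safe #-}
-- Write K = F_{2^m}. A nonzero s with TriEq T (s T) is 1: s permutes the nonzero points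
-- of the plane spanned by the triangle T that lie on its lines, so it fixes the remaining
-- one, a + b + c. Consequently the 18 ratios v/u of ordered pairs (u, v) of distinct
-- nonzero points on a common line of a block are pairwise distinct (two equal ratios give
-- an s mapping the block to a block through the same line), they lie outside K (otherwise
-- ⟨u, v⟩ lies in the group uK), and they are the same for all blocks in an F*-orbit. So the
-- ratio sets of the blocks through the lines ⟨1, t⟩, t ∉ K, partition F ∖ K into classes
-- of size 18, and 18 divides 2^n - 2^m = 2^m (2^(n-m) - 1); as 2 has order 6 modulo 9,
-- 6 divides n - m. Counting |K| = 2^m uses x^(2^n) = x and a root bound: the trace
-- F → K is additive with kernel of size at most 2^(n-m).
module Submission where

open import Defs
open import Data.Nat using (ℕ; _∸_)
open import Data.Nat.Divisibility using (_∣_)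
open import Data.Product using (_×_)

open import Algebra.Bundles using (AbelianGroup; CommutativeMonoid)
open import Algebra.Structures using (IsAbelianGroup)
open import Data.Bool using (Bool; true; false; _xor_)
open import Data.Bool.Properties
  using (xor-assoc; xor-comm; xor-identityˡ; xor-identityʳ; xor-same) renaming (_≟_ to _≟ᵇ_)
open import Data.Empty using (⊥-elim)
open import Data.List
  using (List; []; _∷_; [_]; _++_; map; filter; length; foldr; cartesianProductWith; cartesianProduct)
open import Data.List.Properties
  using (length-++; length-map; length-filter; filter-notAll; map-++; map-∘; map-cong)
open import Data.List.Membership.Propositional using (_∈_; _∉_; lose)
open import Data.List.Membership.Propositional.Properties
  using (∈-filter⁺; ∈-filter⁻; ∈-map⁺; ∈-map⁻; ∈-++⁺ˡ; ∈-++⁺ʳ; ∈-++⁻; ∈-cartesianProductWith⁺; ∈-cartesianProduct⁺)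
open import Data.List.Membership.Propositional.Properties.WithK using (unique∧set⇒bag)
open import Data.List.Relation.Binary.BagAndSetEquality using (∼bag⇒↭)
open import Data.List.Relation.Binary.Permutation.Propositional using (_↭_; ↭⇒↭ₛ′)
open import Data.List.Relation.Binary.Permutation.Propositional.Properties using (↭-length)
open import Data.List.Relation.Unary.All using (All; []; _∷_)
import Data.List.Relation.Unary.All as All
import Data.List.Relation.Unary.All.Properties as Allₚ
open import Data.List.Relation.Unary.AllPairs using ([]; _∷_)
open import Data.List.Relation.Unary.Any using (here; there; any?; satisfied)
open import Data.List.Relation.Unary.Unique.DecPropositional using (unique?)
open import Data.List.Relation.Unary.Unique.Propositional using (Unique)
import Data.List.Relation.Unary.Unique.Propositional.Properties as Uniqueₚ
open import Data.Nat using (zero; suc; pred; _+_; _*_; _^_; _≤_; _<_; _⊔_; z≤n; s≤s; NonZero; >-nonZero⁻¹)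
open import Data.Nat.Coprimality using (coprime?; coprime-divisor)
open import Data.Nat.Divisibility using (divides; _∣0; ∣m∣n⇒∣m+n; ∣-reflexive; ∣-refl; ∣-trans)
open import Data.Nat.DivMod using (_%_; [m+kn]%n≡m%n)
open import Data.Nat.Induction using (<-wellFounded)
import Data.Nat.Properties as ℕ
open import Data.Product using (Σ; ∃; _,_; proj₁; proj₂) renaming (map to ×-map)
open import Data.Product.Properties using () renaming (≡-dec to ×-≡-dec; ,-injective to ×-≡,≡←≡)
open import Data.Sum using (_⊎_; inj₁; inj₂; [_,_]′)
open import Data.Vec using ([]; _∷_)
open import Data.Vec.Properties
  using (zipWith-assoc; zipWith-comm; zipWith-identityˡ; zipWith-identityʳ; zipWith-inverseˡ; map-id; ∷-injective)
  renaming (≡-dec to Vec-≡-dec)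
open import Function using (id; _∘_; mk⇔)
open import Induction.WellFounded using (Acc; acc)
open import Level using (0ℓ)
open import Relation.Binary.Definitions using (DecidableEquality)
open import Relation.Binary.PropositionalEquality
  using (_≡_; _≢_; refl; sym; trans; cong; cong₂; subst; subst₂; isEquivalence; setoid; module ≡-Reasoning)
open import Relation.Nullary using (¬_; Dec; yes; no)
open import Relation.Nullary.Decidable using (¬?; _×-dec_; from-yes)
open import Relation.Unary using (Pred; Decidable)
open import Relation.Unary.Properties using (∁?)

length-cartesianProductWith : ∀ {A B C : Set} (f : A → B → C) xs ys →
  length (cartesianProductWith f xs ys) ≡ length xs * length ys
length-cartesianProductWith f []       ys = refl
length-cartesianProductWith f (x ∷ xs) ys = trans (length-++ (map (f x) ys))
  (cong₂ _+_ (length-map (f x) ys) (length-cartesianProductWith f xs ys))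

module _ {A : Set} where

  Unique-map⁺ : ∀ {B : Set} {f : A → B} {xs} → (∀ {x y} → x ∈ xs → y ∈ xs → f x ≡ f y → x ≡ y) →
    Unique xs → Unique (map f xs)
  Unique-map⁺ {xs = []}     f-injective []                  = []
  Unique-map⁺ {xs = x ∷ xs} f-injective (x∉xs ∷ xs-unique) =
    Allₚ.map⁺ (All.tabulate λ y∈xs fx≡fy → All.lookup x∉xs y∈xs (f-injective (here refl) (there y∈xs) fx≡fy))
    ∷ Unique-map⁺ (λ x∈ y∈ → f-injective (there x∈) (there y∈)) xs-unique

  unique-↭ : ∀ {xs ys : List A} → Unique xs → Unique ys →
    (∀ {z} → z ∈ xs → z ∈ ys) → (∀ {z} → z ∈ ys → z ∈ xs) → xs ↭ ys
  unique-↭ u v f g = ∼bag⇒↭ (unique∧set⇒bag u v (mk⇔ f g))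

  length-filter-∁ : ∀ {P : Pred A 0ℓ} (P? : Decidable P) xs →
    length (filter P? xs) + length (filter (∁? P?) xs) ≡ length xs
  length-filter-∁ P? []       = refl
  length-filter-∁ P? (x ∷ xs) with P? x
  ... | yes _ = cong suc (length-filter-∁ P? xs)
  ... | no _  = trans (ℕ.+-suc _ _) (cong suc (length-filter-∁ P? xs))

module _ {A : Set} (_≟_ : DecidableEquality A) where

  open import Data.List.Membership.DecPropositional _≟_ using (_∈?_)

  unique-⊆⇒length≤ : ∀ {xs ys : List A} → Unique xs → Unique ys →
    (∀ {z} → z ∈ xs → z ∈ ys) → length xs ≤ length ys
  unique-⊆⇒length≤ {xs} {ys} u v xs⊆ys = begin
    length xs                    ≡⟨ ↭-length xs↭ys∩xs ⟩
    length (filter (_∈? xs) ys)  ≤⟨ length-filter (_∈? xs) ys ⟩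
    length ys                    ∎
    where
    open ℕ.≤-Reasoning
    xs↭ys∩xs : xs ↭ filter (_∈? xs) ys
    xs↭ys∩xs = unique-↭ u (Uniqueₚ.filter⁺ (_∈? xs) v)
      (λ z∈xs → ∈-filter⁺ (_∈? xs) (xs⊆ys z∈xs) z∈xs) (λ z∈ → proj₂ (∈-filter⁻ (_∈? xs) {xs = ys} z∈))

  record IsPartition (k : ℕ) (C : A → List A) (xs : List A) : Set where
    field
      unique       : Unique xs
      class-unique : ∀ {x} → x ∈ xs → Unique (C x)
      class-size   : ∀ {x} → x ∈ xs → length (C x) ≡ k
      class-self   : ∀ {x} → x ∈ xs → x ∈ C x
      class-⊆      : ∀ {x y} → x ∈ xs → y ∈ C x → y ∈ xs
      class-≐      : ∀ {x y z} → x ∈ xs → y ∈ C x → (z ∈ C y → z ∈ C x) × (z ∈ C x → z ∈ C y)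

  module _ {k : ℕ} {C : A → List A} where

    partition-outside : ∀ {x xs} → IsPartition k C xs → x ∈ xs →
      IsPartition k C (filter (∁? (_∈? C x)) xs)
    partition-outside {x} {xs} p x∈xs = record
      { unique       = Uniqueₚ.filter⁺ outside? unique
      ; class-unique = class-unique ∘ in-xs
      ; class-size   = class-size ∘ in-xs
      ; class-self   = class-self ∘ in-xs
      ; class-⊆      = stays-outside
      ; class-≐      = class-≐ ∘ in-xs
      }
      where
      open IsPartition p
      outside? = ∁? (_∈? C x)
      in-xs : ∀ {y} → y ∈ filter outside? xs → y ∈ xs
      in-xs y∈ = proj₁ (∈-filter⁻ outside? {xs = xs} y∈)
      stays-outside : ∀ {y z} → y ∈ filter outside? xs → z ∈ C y → z ∈ filter outside? xs
      stays-outside {y} {z} y∈ z∈Cy = ∈-filter⁺ outside? (class-⊆ (in-xs y∈) z∈Cy) z∉Cx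
        where
        -- z ∈ C x would give C y = C z = C x, hence y ∈ C x.
        z∉Cx : z ∉ C x
        z∉Cx z∈Cx = proj₂ (∈-filter⁻ outside? {xs = xs} y∈)
          (proj₁ (class-≐ x∈xs z∈Cx) (proj₂ (class-≐ (in-xs y∈) z∈Cy) (class-self (in-xs y∈))))

    partition-∣ : ∀ xs → IsPartition k C xs → k ∣ length xs
    partition-∣ xs = go xs (<-wellFounded (length xs))
      where
      go : ∀ xs → Acc _<_ (length xs) → IsPartition k C xs → k ∣ length xs
      go []           _          _ = k ∣0
      go xs@(x ∷ _) (acc smaller) p =
        subst (k ∣_) (length-filter-∁ (_∈? C x) xs)
          (∣m∣n⇒∣m+n (∣-reflexive (sym inside-size))
                     (go outside (smaller outside-shorter) (partition-outside p (here refl))))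
        where
        open IsPartition p
        outside = filter (∁? (_∈? C x)) xs
        outside-shorter : length outside < length xs
        outside-shorter = filter-notAll (∁? (_∈? C x)) xs (here (λ x∉ → x∉ (class-self (here refl))))
        inside-size : length (filter (_∈? C x) xs) ≡ k
        inside-size = trans
          (↭-length (unique-↭ (Uniqueₚ.filter⁺ (_∈? C x) unique) (class-unique (here refl))
            (λ z∈ → proj₂ (∈-filter⁻ (_∈? C x) {xs = xs} z∈))
            (λ z∈ → ∈-filter⁺ (_∈? C x) (class-⊆ (here refl) z∈) z∈)))
          (class-size (here refl))

⊕-self : ∀ {n} (x : V n) → x ⊕ x ≡ 𝟎
⊕-self x = trans (cong (_⊕ x) (sym (map-id x))) (zipWith-inverseˡ {⁻¹ = id} xor-same x)

⊕-isAbelianGroup : ∀ n → IsAbelianGroup _≡_ (_⊕_ {n}) 𝟎 id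
⊕-isAbelianGroup n = record
  { isGroup = record
    { isMonoid = record
      { isSemigroup = record
        { isMagma = record { isEquivalence = isEquivalence ; ∙-cong = cong₂ _⊕_ }
        ; assoc = zipWith-assoc xor-assoc }
      ; identity = zipWith-identityˡ xor-identityˡ , zipWith-identityʳ xor-identityʳ }
    ; inverse = ⊕-self , ⊕-self
    ; ⁻¹-cong = id }
  ; comm = zipWith-comm xor-comm }

⊕-abelianGroup : ℕ → AbelianGroup 0ℓ 0ℓ
⊕-abelianGroup n = record { isAbelianGroup = ⊕-isAbelianGroup n }

module _ {n : ℕ} where
  open AbelianGroup (⊕-abelianGroup n) public
    using () renaming (assoc to ⊕-assoc; comm to ⊕-comm; identityˡ to ⊕-identityˡ; identityʳ to ⊕-identityʳ)
  open import Algebra.Properties.AbelianGroup (⊕-abelianGroup n) public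
    using () renaming (∙-cancelʳ to ⊕-cancelʳ; inverseˡ-unique to ⊕-≡𝟎⇒≡)
  open import Algebra.Properties.CommutativeSemigroup (AbelianGroup.commutativeSemigroup (⊕-abelianGroup n)) public
    using () renaming (interchange to ⊕-interchange; xy∙z≈xz∙y to [x⊕y]⊕z≡[x⊕z]⊕y)

x⊕[x⊕y]≡y : ∀ {n} (x y : V n) → x ⊕ (x ⊕ y) ≡ y
x⊕[x⊕y]≡y x y = trans (sym (⊕-assoc x x y)) (trans (cong (_⊕ y) (⊕-self x)) (⊕-identityˡ y))

[x⊕y]⊕[y⊕z]≡x⊕z : ∀ {n} (x y z : V n) → (x ⊕ y) ⊕ (y ⊕ z) ≡ x ⊕ z
[x⊕y]⊕[y⊕z]≡x⊕z x y z = trans (⊕-assoc x y (y ⊕ z)) (cong (x ⊕_) (x⊕[x⊕y]≡y y z))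

_≟ⱽ_ : ∀ {n} → DecidableEquality (V n)
_≟ⱽ_ = Vec-≡-dec _≟ᵇ_

bits : List Bool
bits = true ∷ false ∷ []

vectors : ∀ n → List (V n)
vectors zero    = [ [] ]
vectors (suc n) = cartesianProductWith _∷_ bits (vectors n)

∈-vectors : ∀ {n} (x : V n) → x ∈ vectors n
∈-vectors []          = here refl
∈-vectors (true ∷ x)  = ∈-cartesianProductWith⁺ _∷_ {bits} (here refl) (∈-vectors x)
∈-vectors (false ∷ x) = ∈-cartesianProductWith⁺ _∷_ {bits} (there (here refl)) (∈-vectors x)

vectors-unique : ∀ n → Unique (vectors n)
vectors-unique zero    = [] ∷ []
vectors-unique (suc n) =
  Uniqueₚ.cartesianProductWith⁺ _∷_ ∷-injective (((λ ()) ∷ []) ∷ [] ∷ []) (vectors-unique n)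

length-vectors : ∀ n → length (vectors n) ≡ 2 ^ n
length-vectors zero    = refl
length-vectors (suc n) = trans (length-cartesianProductWith _∷_ bits (vectors n))
  (cong (2 *_) (length-vectors n))

module _ {n : ℕ} (f : V n → V n) (f-⊕ : ∀ x y → f (x ⊕ y) ≡ f x ⊕ f y) where

  private
    preimage : V n → V n
    preimage y with any? (λ x → f x ≟ⱽ y) (vectors n)
    ... | yes found = proj₁ (satisfied found)
    ... | no _      = 𝟎

    f-preimage : ∀ x → f (preimage (f x)) ≡ f x
    f-preimage x with any? (λ z → f z ≟ⱽ f x) (vectors n)
    ... | yes found = proj₂ (satisfied found)
    ... | no none   = ⊥-elim (none (lose (∈-vectors x) refl))

  rank-nullity-bound : ∀ {image kernel} → Unique image → Unique kernel →
    (∀ x → f x ∈ image) → (∀ {x} → f x ≡ 𝟎 → x ∈ kernel) →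
    2 ^ n ≤ length image * length kernel
  rank-nullity-bound {image} {kernel} image-unique kernel-unique f∈image ∈kernel = begin
    2 ^ n                                     ≡⟨ length-vectors n ⟨
    length (vectors n)                        ≡⟨ length-map split (vectors n) ⟨
    length (map split (vectors n))            ≤⟨ unique-⊆⇒length≤ (×-≡-dec _≟ⱽ_ _≟ⱽ_)
                                                   (Uniqueₚ.map⁺ split-injective (vectors-unique n))
                                                   (Uniqueₚ.cartesianProduct⁺ image-unique kernel-unique)
                                                   split∈ ⟩
    length (cartesianProduct image kernel)    ≡⟨ length-cartesianProductWith _,_ image kernel ⟩
    length image * length kernel              ∎
    where
    open ℕ.≤-Reasoning
    split : V n → V n × V n
    split x = f x , x ⊕ preimage (f x)

    split-injective : ∀ {x y} → split x ≡ split y → x ≡ y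
    split-injective {x} {y} eq with ×-≡,≡←≡ eq
    ... | fx≡fy , snd≡ = ⊕-cancelʳ (preimage (f x)) x y
      (trans snd≡ (cong (λ z → y ⊕ preimage z) (sym fx≡fy)))

    split∈ : ∀ {p} → p ∈ map split (vectors n) → p ∈ cartesianProduct image kernel
    split∈ p∈ with ∈-map⁻ split p∈
    ... | x , _ , refl = ∈-cartesianProduct⁺ (f∈image x) (∈kernel
      (trans (f-⊕ x (preimage (f x))) (trans (cong (f x ⊕_) (f-preimage x)) (⊕-self (f x)))))

module FieldTheory {n : ℕ} (F : FieldOn n) where
  open FieldOn F
  open ≡-Reasoning

  ⊛-commutativeMonoid : CommutativeMonoid 0ℓ 0ℓ
  ⊛-commutativeMonoid = record
    { isCommutativeMonoid = record
      { isMonoid = record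
        { isSemigroup = record
          { isMagma = record { isEquivalence = isEquivalence ; ∙-cong = cong₂ _⊛_ }
          ; assoc = ⊛-assoc }
        ; identity = ⊛-identityˡ , λ x → trans (⊛-comm x 𝟏) (⊛-identityˡ x) }
      ; comm = ⊛-comm } }

  open CommutativeMonoid ⊛-commutativeMonoid public
    using () renaming (identityʳ to ⊛-identityʳ; isCommutativeMonoid to ⊛-isCommutativeMonoid)
  open import Algebra.Properties.CommutativeSemigroup
    (CommutativeMonoid.commutativeSemigroup ⊛-commutativeMonoid) public
    using () renaming (interchange to ⊛-interchange; x∙yz≈y∙xz to x⊛[y⊛z]≡y⊛[x⊛z])

  ⊛-distribʳ : ∀ x y z → (y ⊕ z) ⊛ x ≡ (y ⊛ x) ⊕ (z ⊛ x)
  ⊛-distribʳ x y z = begin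
    (y ⊕ z) ⊛ x         ≡⟨ ⊛-comm (y ⊕ z) x ⟩
    x ⊛ (y ⊕ z)         ≡⟨ ⊛-distribˡ x y z ⟩
    (x ⊛ y) ⊕ (x ⊛ z)   ≡⟨ cong₂ _⊕_ (⊛-comm x y) (⊛-comm x z) ⟩
    (y ⊛ x) ⊕ (z ⊛ x)   ∎

  ⊛-zeroʳ : ∀ x → x ⊛ 𝟎 ≡ 𝟎
  ⊛-zeroʳ x = begin
    x ⊛ 𝟎               ≡⟨ cong (x ⊛_) (sym (⊕-self 𝟎)) ⟩
    x ⊛ (𝟎 ⊕ 𝟎)         ≡⟨ ⊛-distribˡ x 𝟎 𝟎 ⟩
    (x ⊛ 𝟎) ⊕ (x ⊛ 𝟎)   ≡⟨ ⊕-self (x ⊛ 𝟎) ⟩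
    𝟎                   ∎

  ⊛-zeroˡ : ∀ x → 𝟎 ⊛ x ≡ 𝟎
  ⊛-zeroˡ x = trans (⊛-comm 𝟎 x) (⊛-zeroʳ x)

  infix 30 _⁻¹

  -- 𝟎 ⁻¹ = 𝟎 is a junk value.
  _⁻¹ : V n → V n
  x ⁻¹ with x ≟ⱽ 𝟎
  ... | yes _   = 𝟎
  ... | no x≢𝟎 = proj₁ (⊛-inverse x x≢𝟎)

  𝟎⁻¹ : 𝟎 ⁻¹ ≡ 𝟎
  𝟎⁻¹ with 𝟎 {n} ≟ⱽ 𝟎
  ... | yes _   = refl
  ... | no 𝟎≢𝟎 = ⊥-elim (𝟎≢𝟎 refl)

  ⊛-inverseʳ : ∀ {x} → x ≢ 𝟎 → x ⊛ x ⁻¹ ≡ 𝟏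
  ⊛-inverseʳ {x} x≢𝟎 with x ≟ⱽ 𝟎
  ... | yes x≡𝟎 = ⊥-elim (x≢𝟎 x≡𝟎)
  ... | no x≢𝟎′ = proj₂ (⊛-inverse x x≢𝟎′)

  ⊛-inverseˡ : ∀ {x} → x ≢ 𝟎 → x ⁻¹ ⊛ x ≡ 𝟏
  ⊛-inverseˡ {x} x≢𝟎 = trans (⊛-comm (x ⁻¹) x) (⊛-inverseʳ x≢𝟎)

  x⁻¹⊛[x⊛y]≡y : ∀ {x} y → x ≢ 𝟎 → x ⁻¹ ⊛ (x ⊛ y) ≡ y
  x⁻¹⊛[x⊛y]≡y {x} y x≢𝟎 = begin
    x ⁻¹ ⊛ (x ⊛ y)      ≡⟨ ⊛-assoc (x ⁻¹) x y ⟨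
    (x ⁻¹ ⊛ x) ⊛ y      ≡⟨ cong (_⊛ y) (⊛-inverseˡ x≢𝟎) ⟩
    𝟏 ⊛ y               ≡⟨ ⊛-identityˡ y ⟩
    y                   ∎

  x⊛[x⁻¹⊛y]≡y : ∀ {x} y → x ≢ 𝟎 → x ⊛ (x ⁻¹ ⊛ y) ≡ y
  x⊛[x⁻¹⊛y]≡y {x} y x≢𝟎 = begin
    x ⊛ (x ⁻¹ ⊛ y)      ≡⟨ ⊛-assoc x (x ⁻¹) y ⟨
    (x ⊛ x ⁻¹) ⊛ y      ≡⟨ cong (_⊛ y) (⊛-inverseʳ x≢𝟎) ⟩
    𝟏 ⊛ y               ≡⟨ ⊛-identityˡ y ⟩
    y                   ∎

  ⊛-cancelˡ : ∀ {x y z} → x ≢ 𝟎 → x ⊛ y ≡ x ⊛ z → y ≡ z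
  ⊛-cancelˡ {x} {y} {z} x≢𝟎 xy≡xz = begin
    y                   ≡⟨ x⁻¹⊛[x⊛y]≡y y x≢𝟎 ⟨
    x ⁻¹ ⊛ (x ⊛ y)      ≡⟨ cong (x ⁻¹ ⊛_) xy≡xz ⟩
    x ⁻¹ ⊛ (x ⊛ z)      ≡⟨ x⁻¹⊛[x⊛y]≡y z x≢𝟎 ⟩
    z                   ∎

  ⊛≡𝟎⇒≡𝟎 : ∀ {x y} → x ≢ 𝟎 → x ⊛ y ≡ 𝟎 → y ≡ 𝟎
  ⊛≡𝟎⇒≡𝟎 {x} x≢𝟎 xy≡𝟎 = ⊛-cancelˡ x≢𝟎 (trans xy≡𝟎 (sym (⊛-zeroʳ x)))

  ⊛-nonzero : ∀ {x y} → x ≢ 𝟎 → y ≢ 𝟎 → x ⊛ y ≢ 𝟎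
  ⊛-nonzero x≢𝟎 y≢𝟎 = y≢𝟎 ∘ ⊛≡𝟎⇒≡𝟎 x≢𝟎

  ⁻¹-nonzero : ∀ {x} → x ≢ 𝟎 → x ⁻¹ ≢ 𝟎
  ⁻¹-nonzero {x} x≢𝟎 x⁻¹≡𝟎 = 𝟏≢𝟎 (begin
    𝟏                   ≡⟨ ⊛-inverseʳ x≢𝟎 ⟨
    x ⊛ x ⁻¹            ≡⟨ cong (x ⊛_) x⁻¹≡𝟎 ⟩
    x ⊛ 𝟎               ≡⟨ ⊛-zeroʳ x ⟩
    𝟎                   ∎)

  ⁻¹-unique : ∀ {x y} → x ⊛ y ≡ 𝟏 → y ≡ x ⁻¹
  ⁻¹-unique {x} {y} xy≡𝟏 = ⊛-cancelˡ x≢𝟎 (trans xy≡𝟏 (sym (⊛-inverseʳ x≢𝟎)))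
    where
    x≢𝟎 : x ≢ 𝟎
    x≢𝟎 x≡𝟎 = 𝟏≢𝟎 (trans (sym xy≡𝟏) (trans (cong (_⊛ y) x≡𝟎) (⊛-zeroˡ y)))

  ⁻¹-distrib-⊛ : ∀ {s} x → s ≢ 𝟎 → (s ⊛ x) ⁻¹ ≡ s ⁻¹ ⊛ x ⁻¹
  ⁻¹-distrib-⊛ {s} x s≢𝟎 = by-cases (x ≟ⱽ 𝟎)
    where
    by-cases : Dec (x ≡ 𝟎) → (s ⊛ x) ⁻¹ ≡ s ⁻¹ ⊛ x ⁻¹
    by-cases (yes refl) = begin
      (s ⊛ 𝟎) ⁻¹          ≡⟨ cong _⁻¹ (⊛-zeroʳ s) ⟩
      𝟎 ⁻¹                ≡⟨ 𝟎⁻¹ ⟩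
      𝟎                   ≡⟨ ⊛-zeroʳ (s ⁻¹) ⟨
      s ⁻¹ ⊛ 𝟎            ≡⟨ cong (s ⁻¹ ⊛_) 𝟎⁻¹ ⟨
      s ⁻¹ ⊛ 𝟎 ⁻¹         ∎
    by-cases (no x≢𝟎) = sym (⁻¹-unique (begin
      (s ⊛ x) ⊛ (s ⁻¹ ⊛ x ⁻¹)  ≡⟨ ⊛-interchange s x (s ⁻¹) (x ⁻¹) ⟩
      (s ⊛ s ⁻¹) ⊛ (x ⊛ x ⁻¹)  ≡⟨ cong₂ _⊛_ (⊛-inverseʳ s≢𝟎) (⊛-inverseʳ x≢𝟎) ⟩
      𝟏 ⊛ 𝟏                    ≡⟨ ⊛-identityˡ 𝟏 ⟩
      𝟏                        ∎))

  pow-+ : ∀ x a b → pow F x (a + b) ≡ pow F x a ⊛ pow F x b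
  pow-+ x zero    b = sym (⊛-identityˡ (pow F x b))
  pow-+ x (suc a) b = trans (cong (x ⊛_) (pow-+ x a b)) (sym (⊛-assoc x (pow F x a) (pow F x b)))

  pow-* : ∀ x a b → pow F x (a * b) ≡ pow F (pow F x a) b
  pow-* x a zero    = cong (pow F x) (ℕ.*-zeroʳ a)
  pow-* x a (suc b) = begin
    pow F x (a * suc b)                  ≡⟨ cong (pow F x) (ℕ.*-suc a b) ⟩
    pow F x (a + a * b)                  ≡⟨ pow-+ x a (a * b) ⟩
    pow F x a ⊛ pow F x (a * b)          ≡⟨ cong (pow F x a ⊛_) (pow-* x a b) ⟩
    pow F x a ⊛ pow F (pow F x a) b      ∎

  pow-⊛ : ∀ x y k → pow F (x ⊛ y) k ≡ pow F x k ⊛ pow F y k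
  pow-⊛ x y zero    = sym (⊛-identityˡ 𝟏)
  pow-⊛ x y (suc k) = trans (cong ((x ⊛ y) ⊛_) (pow-⊛ x y k)) (⊛-interchange x y (pow F x k) (pow F y k))

  pow-𝟏 : ∀ k → pow F 𝟏 k ≡ 𝟏
  pow-𝟏 zero    = refl
  pow-𝟏 (suc k) = trans (⊛-identityˡ (pow F 𝟏 k)) (pow-𝟏 k)

  pow-𝟎 : ∀ k → .{{NonZero k}} → pow F 𝟎 k ≡ 𝟎
  pow-𝟎 (suc k) = ⊛-zeroˡ (pow F 𝟎 k)

  square-⊕ : ∀ x y → pow F (x ⊕ y) 2 ≡ pow F x 2 ⊕ pow F y 2
  square-⊕ x y = begin
    (x ⊕ y) ⊛ ((x ⊕ y) ⊛ 𝟏)                    ≡⟨ cong ((x ⊕ y) ⊛_) (⊛-identityʳ (x ⊕ y)) ⟩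
    (x ⊕ y) ⊛ (x ⊕ y)                          ≡⟨ ⊛-distribʳ (x ⊕ y) x y ⟩
    (x ⊛ (x ⊕ y)) ⊕ (y ⊛ (x ⊕ y))              ≡⟨ cong₂ _⊕_ (⊛-distribˡ x x y) (⊛-distribˡ y x y) ⟩
    ((x ⊛ x) ⊕ (x ⊛ y)) ⊕ ((y ⊛ x) ⊕ (y ⊛ y))  ≡⟨ cong (λ z → ((x ⊛ x) ⊕ (x ⊛ y)) ⊕ (z ⊕ (y ⊛ y))) (⊛-comm y x) ⟩
    ((x ⊛ x) ⊕ (x ⊛ y)) ⊕ ((x ⊛ y) ⊕ (y ⊛ y))  ≡⟨ [x⊕y]⊕[y⊕z]≡x⊕z (x ⊛ x) (x ⊛ y) (y ⊛ y) ⟩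
    (x ⊛ x) ⊕ (y ⊛ y)                          ≡⟨ cong₂ (λ u v → (x ⊛ u) ⊕ (y ⊛ v)) (⊛-identityʳ x) (⊛-identityʳ y) ⟨
    pow F x 2 ⊕ pow F y 2                      ∎

  frobenius : ∀ k x y → pow F (x ⊕ y) (2 ^ k) ≡ pow F x (2 ^ k) ⊕ pow F y (2 ^ k)
  frobenius zero    x y = ⊛-distribʳ 𝟏 x y
  frobenius (suc k) x y = begin
    pow F (x ⊕ y) (2 * 2 ^ k)                          ≡⟨ pow-* (x ⊕ y) 2 (2 ^ k) ⟩
    pow F (pow F (x ⊕ y) 2) (2 ^ k)                    ≡⟨ cong (λ z → pow F z (2 ^ k)) (square-⊕ x y) ⟩
    pow F (pow F x 2 ⊕ pow F y 2) (2 ^ k)              ≡⟨ frobenius k (pow F x 2) (pow F y 2) ⟩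
    pow F (pow F x 2) (2 ^ k) ⊕ pow F (pow F y 2) (2 ^ k)  ≡⟨ cong₂ _⊕_ (pow-* x 2 (2 ^ k)) (pow-* y 2 (2 ^ k)) ⟨
    pow F x (2 * 2 ^ k) ⊕ pow F y (2 * 2 ^ k)          ∎

  module _ (m : ℕ) where

    subfield-𝟎 : InSubfield F m 𝟎
    subfield-𝟎 = pow-𝟎 (2 ^ m) {{ℕ.m^n≢0 2 m}}

    subfield-𝟏 : InSubfield F m 𝟏
    subfield-𝟏 = pow-𝟏 (2 ^ m)

    subfield-⊕ : ∀ {x y} → InSubfield F m x → InSubfield F m y → InSubfield F m (x ⊕ y)
    subfield-⊕ {x} {y} x∈K y∈K = trans (frobenius m x y) (cong₂ _⊕_ x∈K y∈K)

    subfield-⊛ : ∀ {x y} → InSubfield F m x → InSubfield F m y → InSubfield F m (x ⊛ y)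
    subfield-⊛ {x} {y} x∈K y∈K = trans (pow-⊛ x y (2 ^ m)) (cong₂ _⊛_ x∈K y∈K)

    subfield-⁻¹ : ∀ {x} → x ≢ 𝟎 → InSubfield F m x → InSubfield F m (x ⁻¹)
    subfield-⁻¹ {x} x≢𝟎 x∈K = ⁻¹-unique (begin
      x ⊛ pow F (x ⁻¹) (2 ^ m)                  ≡⟨ cong (_⊛ pow F (x ⁻¹) (2 ^ m)) x∈K ⟨
      pow F x (2 ^ m) ⊛ pow F (x ⁻¹) (2 ^ m)    ≡⟨ pow-⊛ x (x ⁻¹) (2 ^ m) ⟨
      pow F (x ⊛ x ⁻¹) (2 ^ m)                  ≡⟨ cong (λ z → pow F z (2 ^ m)) (⊛-inverseʳ x≢𝟎) ⟩
      pow F 𝟏 (2 ^ m)                           ≡⟨ pow-𝟏 (2 ^ m) ⟩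
      𝟏                                         ∎)

  product : List (V n) → V n
  product = foldr _⊛_ 𝟏

  product-↭ : ∀ {xs ys} → xs ↭ ys → product xs ≡ product ys
  product-↭ xs↭ys = foldr-commMonoid ⊛-isCommutativeMonoid (↭⇒↭ₛ′ isEquivalence xs↭ys)
    where open import Data.List.Relation.Binary.Permutation.Setoid.Properties (setoid (V n)) using (foldr-commMonoid)

  product-map-⊛ : ∀ a xs → product (map (a ⊛_) xs) ≡ pow F a (length xs) ⊛ product xs
  product-map-⊛ a []       = sym (⊛-identityˡ 𝟏)
  product-map-⊛ a (x ∷ xs) = trans (cong ((a ⊛ x) ⊛_) (product-map-⊛ a xs))
    (⊛-interchange a x (pow F a (length xs)) (product xs))

  product-nonzero : ∀ {xs} → All (_≢ 𝟎) xs → product xs ≢ 𝟎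
  product-nonzero []           = 𝟏≢𝟎
  product-nonzero (x≢𝟎 ∷ xs≢𝟎) = ⊛-nonzero x≢𝟎 (product-nonzero xs≢𝟎)

  units : List (V n)
  units = filter (∁? (_≟ⱽ 𝟎)) (vectors n)

  ∈-units : ∀ {x} → x ≢ 𝟎 → x ∈ units
  ∈-units {x} x≢𝟎 = ∈-filter⁺ (∁? (_≟ⱽ 𝟎)) (∈-vectors x) x≢𝟎

  suc-length-units : suc (length units) ≡ 2 ^ n
  suc-length-units = begin
    suc (length units)                                 ≡⟨ cong (_+ length units) length-zeros ⟨
    length zeros + length units                        ≡⟨ length-filter-∁ (_≟ⱽ 𝟎) (vectors n) ⟩
    length (vectors n)                                 ≡⟨ length-vectors n ⟩
    2 ^ n                                              ∎
    where
    zeros = filter (_≟ⱽ 𝟎) (vectors n)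
    length-zeros : length zeros ≡ 1
    length-zeros = ↭-length {ys = [ 𝟎 ]} (unique-↭ (Uniqueₚ.filter⁺ (_≟ⱽ 𝟎) (vectors-unique n)) ([] ∷ [])
      (λ z∈ → here (proj₂ (∈-filter⁻ (_≟ⱽ 𝟎) {xs = vectors n} z∈)))
      (λ { (here refl) → ∈-filter⁺ (_≟ⱽ 𝟎) (∈-vectors 𝟎) refl }))

  -- Multiplication by a permutes the units, so it fixes their product.
  pow-length-units : ∀ {a} → a ≢ 𝟎 → pow F a (length units) ≡ 𝟏
  pow-length-units {a} a≢𝟎 = ⊛-cancelˡ (product-nonzero (Allₚ.all-filter (∁? (_≟ⱽ 𝟎)) (vectors n))) (begin
    product units ⊛ pow F a (length units)   ≡⟨ ⊛-comm (product units) (pow F a (length units)) ⟩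
    pow F a (length units) ⊛ product units   ≡⟨ product-map-⊛ a units ⟨
    product (map (a ⊛_) units)               ≡⟨ product-↭ scaled-units↭units ⟩
    product units                            ≡⟨ ⊛-identityʳ (product units) ⟨
    product units ⊛ 𝟏                        ∎)
    where
    unit : ∀ {x} → x ∈ units → x ≢ 𝟎
    unit x∈ = proj₂ (∈-filter⁻ (∁? (_≟ⱽ 𝟎)) {xs = vectors n} x∈)
    scaled-units↭units : map (a ⊛_) units ↭ units
    scaled-units↭units = unique-↭
      (Uniqueₚ.map⁺ (⊛-cancelˡ a≢𝟎) (Uniqueₚ.filter⁺ (∁? (_≟ⱽ 𝟎)) (vectors-unique n)))
      (Uniqueₚ.filter⁺ (∁? (_≟ⱽ 𝟎)) (vectors-unique n))
      (λ z∈ → let (x , x∈ , z≡ax) = ∈-map⁻ (a ⊛_) z∈ in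
        subst (_∈ units) (sym z≡ax) (∈-units (⊛-nonzero a≢𝟎 (unit x∈))))
      (λ {z} z∈ → subst (_∈ map (a ⊛_) units) (x⊛[x⁻¹⊛y]≡y z a≢𝟎)
        (∈-map⁺ (a ⊛_) (∈-units (⊛-nonzero (⁻¹-nonzero a≢𝟎) (unit z∈)))))

  fermat : ∀ x → pow F x (2 ^ n) ≡ x
  fermat x with x ≟ⱽ 𝟎
  ... | yes refl = pow-𝟎 (2 ^ n) {{ℕ.m^n≢0 2 n}}
  ... | no x≢𝟎  = begin
    pow F x (2 ^ n)                ≡⟨ cong (pow F x) suc-length-units ⟨
    x ⊛ pow F x (length units)     ≡⟨ cong (x ⊛_) (pow-length-units x≢𝟎) ⟩
    x ⊛ 𝟏                          ≡⟨ ⊛-identityʳ x ⟩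
    x                              ∎


module Polynomial {n : ℕ} (F : FieldOn n) where
  open FieldOn F
  open FieldTheory F
  open ≡-Reasoning

  -- Coefficient lists, constant term first.
  Poly : Set
  Poly = List (V n)

  eval : Poly → V n → V n
  eval []      x = 𝟎
  eval (c ∷ p) x = c ⊕ (x ⊛ eval p x)

  coeff : Poly → ℕ → V n
  coeff []      i       = 𝟎
  coeff (c ∷ p) zero    = c
  coeff (c ∷ p) (suc i) = coeff p i

  IsZero : Poly → Set
  IsZero = All (_≡ 𝟎)

  IsZero⇒coeff≡𝟎 : ∀ {p} → IsZero p → ∀ i → coeff p i ≡ 𝟎
  IsZero⇒coeff≡𝟎 []           i       = refl
  IsZero⇒coeff≡𝟎 (c≡𝟎 ∷ _)    zero    = c≡𝟎
  IsZero⇒coeff≡𝟎 (_ ∷ p≡𝟎)    (suc i) = IsZero⇒coeff≡𝟎 p≡𝟎 i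

  quotient : Poly → V n → Poly
  quotient []          r = []
  quotient (c ∷ [])    r = []
  quotient (c ∷ d ∷ p) r = eval (d ∷ p) r ∷ quotient (d ∷ p) r

  length-quotient : ∀ p r → length (quotient p r) ≡ pred (length p)
  length-quotient []          r = refl
  length-quotient (c ∷ [])    r = refl
  length-quotient (c ∷ d ∷ p) r = cong suc (length-quotient (d ∷ p) r)

  eval-quotient : ∀ p x r → eval p x ⊕ eval p r ≡ (x ⊕ r) ⊛ eval (quotient p r) x
  eval-quotient [] x r = trans (⊕-self 𝟎) (sym (⊛-zeroʳ (x ⊕ r)))
  eval-quotient (c ∷ []) x r = begin
    (c ⊕ (x ⊛ 𝟎)) ⊕ (c ⊕ (r ⊛ 𝟎))   ≡⟨ cong₂ (λ u v → (c ⊕ u) ⊕ (c ⊕ v)) (⊛-zeroʳ x) (⊛-zeroʳ r) ⟩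
    (c ⊕ 𝟎) ⊕ (c ⊕ 𝟎)               ≡⟨ ⊕-self (c ⊕ 𝟎) ⟩
    𝟎                               ≡⟨ ⊛-zeroʳ (x ⊕ r) ⟨
    (x ⊕ r) ⊛ 𝟎                     ∎
  eval-quotient (c ∷ q@(d ∷ p)) x r = begin
    (c ⊕ (x ⊛ Qx)) ⊕ (c ⊕ (r ⊛ Qr))          ≡⟨ ⊕-interchange c (x ⊛ Qx) c (r ⊛ Qr) ⟩
    (c ⊕ c) ⊕ ((x ⊛ Qx) ⊕ (r ⊛ Qr))          ≡⟨ cong (_⊕ ((x ⊛ Qx) ⊕ (r ⊛ Qr))) (⊕-self c) ⟩
    𝟎 ⊕ ((x ⊛ Qx) ⊕ (r ⊛ Qr))                ≡⟨ ⊕-identityˡ ((x ⊛ Qx) ⊕ (r ⊛ Qr)) ⟩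
    (x ⊛ Qx) ⊕ (r ⊛ Qr)                      ≡⟨ cong ((x ⊛ Qx) ⊕_) (x⊕[x⊕y]≡y (x ⊛ Qr) (r ⊛ Qr)) ⟨
    (x ⊛ Qx) ⊕ ((x ⊛ Qr) ⊕ ((x ⊛ Qr) ⊕ (r ⊛ Qr)))   ≡⟨ ⊕-assoc (x ⊛ Qx) (x ⊛ Qr) _ ⟨
    ((x ⊛ Qx) ⊕ (x ⊛ Qr)) ⊕ ((x ⊛ Qr) ⊕ (r ⊛ Qr))   ≡⟨ cong₂ _⊕_ (⊛-distribˡ x Qx Qr) (⊛-distribʳ Qr x r) ⟨
    (x ⊛ (Qx ⊕ Qr)) ⊕ ((x ⊕ r) ⊛ Qr)         ≡⟨ cong (λ z → (x ⊛ z) ⊕ ((x ⊕ r) ⊛ Qr)) (eval-quotient q x r) ⟩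
    (x ⊛ ((x ⊕ r) ⊛ E)) ⊕ ((x ⊕ r) ⊛ Qr)     ≡⟨ cong (_⊕ ((x ⊕ r) ⊛ Qr)) (x⊛[y⊛z]≡y⊛[x⊛z] x (x ⊕ r) E) ⟩
    ((x ⊕ r) ⊛ (x ⊛ E)) ⊕ ((x ⊕ r) ⊛ Qr)     ≡⟨ ⊛-distribˡ (x ⊕ r) (x ⊛ E) Qr ⟨
    (x ⊕ r) ⊛ ((x ⊛ E) ⊕ Qr)                 ≡⟨ cong ((x ⊕ r) ⊛_) (⊕-comm (x ⊛ E) Qr) ⟩
    (x ⊕ r) ⊛ (Qr ⊕ (x ⊛ E))                 ∎
    where
    Qx = eval q x
    Qr = eval q r
    E  = eval (quotient q r) x

  quotient-IsZero : ∀ p r → IsZero (quotient p r) → eval p r ≡ 𝟎 → IsZero p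
  quotient-IsZero []          r _ _ = []
  quotient-IsZero (c ∷ [])    r _ p[r]≡𝟎 =
    trans (sym (trans (cong (c ⊕_) (⊛-zeroʳ r)) (⊕-identityʳ c))) p[r]≡𝟎 ∷ []
  quotient-IsZero (c ∷ q@(_ ∷ _)) r (q[r]≡𝟎 ∷ quotient≡𝟎) p[r]≡𝟎 =
    c≡𝟎 ∷ quotient-IsZero q r quotient≡𝟎 q[r]≡𝟎
    where
    c≡𝟎 : c ≡ 𝟎
    c≡𝟎 = begin
      c                    ≡⟨ ⊕-identityʳ c ⟨
      c ⊕ 𝟎                ≡⟨ cong (c ⊕_) (⊛-zeroʳ r) ⟨
      c ⊕ (r ⊛ 𝟎)          ≡⟨ cong (λ z → c ⊕ (r ⊛ z)) q[r]≡𝟎 ⟨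
      c ⊕ (r ⊛ eval q r)   ≡⟨ p[r]≡𝟎 ⟩
      𝟎                    ∎

  roots-bound : ∀ p {rs} → ¬ IsZero p → Unique rs → All (λ r → eval p r ≡ 𝟎) rs →
    length rs < length p
  roots-bound []      p≢𝟎 _ _ = ⊥-elim (p≢𝟎 [])
  roots-bound (_ ∷ _) _ [] [] = s≤s z≤n
  roots-bound p@(_ ∷ _) {r ∷ rs} p≢𝟎 (r∉rs ∷ rs-unique) (p[r]≡𝟎 ∷ rs-roots) =
    s≤s (subst (length rs <_) (length-quotient p r)
      (roots-bound (quotient p r) (λ q≡𝟎 → p≢𝟎 (quotient-IsZero p r q≡𝟎 p[r]≡𝟎)) rs-unique
        (All.zipWith quotient-root (r∉rs , rs-roots))))
    where
    quotient-root : ∀ {s} → r ≢ s × eval p s ≡ 𝟎 → eval (quotient p r) s ≡ 𝟎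
    quotient-root {s} (r≢s , p[s]≡𝟎) = ⊛≡𝟎⇒≡𝟎 (λ s⊕r≡𝟎 → r≢s (sym (⊕-≡𝟎⇒≡ s r s⊕r≡𝟎))) (begin
      (s ⊕ r) ⊛ eval (quotient p r) s   ≡⟨ eval-quotient p s r ⟨
      eval p s ⊕ eval p r               ≡⟨ cong₂ _⊕_ p[s]≡𝟎 p[r]≡𝟎 ⟩
      𝟎 ⊕ 𝟎                             ≡⟨ ⊕-self 𝟎 ⟩
      𝟎                                 ∎)

  monomial : ℕ → Poly
  monomial zero    = [ 𝟏 ]
  monomial (suc k) = 𝟎 ∷ monomial k

  eval-monomial : ∀ k x → eval (monomial k) x ≡ pow F x k
  eval-monomial zero    x = trans (cong (𝟏 ⊕_) (⊛-zeroʳ x)) (⊕-identityʳ 𝟏)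
  eval-monomial (suc k) x = trans (⊕-identityˡ (x ⊛ eval (monomial k) x)) (cong (x ⊛_) (eval-monomial k x))

  length-monomial : ∀ k → length (monomial k) ≡ suc k
  length-monomial zero    = refl
  length-monomial (suc k) = cong suc (length-monomial k)

  coeff-monomial-≢ : ∀ {i k} → i ≢ k → coeff (monomial k) i ≡ 𝟎
  coeff-monomial-≢ {zero}  {zero}  0≢0 = ⊥-elim (0≢0 refl)
  coeff-monomial-≢ {suc i} {zero}  _   = refl
  coeff-monomial-≢ {zero}  {suc k} _   = refl
  coeff-monomial-≢ {suc i} {suc k} i≢k = coeff-monomial-≢ (i≢k ∘ cong suc)

  _+ₚ_ : Poly → Poly → Poly
  []      +ₚ q       = q
  (a ∷ p) +ₚ []      = a ∷ p
  (a ∷ p) +ₚ (b ∷ q) = (a ⊕ b) ∷ (p +ₚ q)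

  eval-+ₚ : ∀ p q x → eval (p +ₚ q) x ≡ eval p x ⊕ eval q x
  eval-+ₚ []      q       x = sym (⊕-identityˡ (eval q x))
  eval-+ₚ (a ∷ p) []      x = sym (⊕-identityʳ (eval (a ∷ p) x))
  eval-+ₚ (a ∷ p) (b ∷ q) x = begin
    (a ⊕ b) ⊕ (x ⊛ eval (p +ₚ q) x)                   ≡⟨ cong (λ z → (a ⊕ b) ⊕ (x ⊛ z)) (eval-+ₚ p q x) ⟩
    (a ⊕ b) ⊕ (x ⊛ (eval p x ⊕ eval q x))             ≡⟨ cong ((a ⊕ b) ⊕_) (⊛-distribˡ x (eval p x) (eval q x)) ⟩
    (a ⊕ b) ⊕ ((x ⊛ eval p x) ⊕ (x ⊛ eval q x))       ≡⟨ ⊕-interchange a b (x ⊛ eval p x) (x ⊛ eval q x) ⟩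
    (a ⊕ (x ⊛ eval p x)) ⊕ (b ⊕ (x ⊛ eval q x))       ∎

  coeff-+ₚ : ∀ p q i → coeff (p +ₚ q) i ≡ coeff p i ⊕ coeff q i
  coeff-+ₚ []      q       i       = sym (⊕-identityˡ (coeff q i))
  coeff-+ₚ (a ∷ p) []      i       = sym (⊕-identityʳ (coeff (a ∷ p) i))
  coeff-+ₚ (a ∷ p) (b ∷ q) zero    = refl
  coeff-+ₚ (a ∷ p) (b ∷ q) (suc i) = coeff-+ₚ p q i

  length-+ₚ : ∀ p q → length (p +ₚ q) ≡ length p ⊔ length q
  length-+ₚ []      q       = refl
  length-+ₚ (a ∷ p) []      = refl
  length-+ₚ (a ∷ p) (b ∷ q) = cong suc (length-+ₚ p q)

module SubfieldSize {n : ℕ} (F : FieldOn n) (m : ℕ) where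
  open FieldOn F
  open FieldTheory F
  open Polynomial F

  tracePoly : ℕ → Poly
  tracePoly zero    = []
  tracePoly (suc k) = tracePoly k +ₚ monomial (2 ^ (k * m))

  trace : ℕ → V n → V n
  trace k = eval (tracePoly k)

  trace-suc : ∀ k x → trace (suc k) x ≡ trace k x ⊕ pow F x (2 ^ (k * m))
  trace-suc k x = trans (eval-+ₚ (tracePoly k) (monomial (2 ^ (k * m))) x)
    (cong (trace k x ⊕_) (eval-monomial (2 ^ (k * m)) x))

  trace-⊕ : ∀ k x y → trace k (x ⊕ y) ≡ trace k x ⊕ trace k y
  trace-⊕ zero    x y = sym (⊕-self 𝟎)
  trace-⊕ (suc k) x y = begin
    trace (suc k) (x ⊕ y)                                     ≡⟨ trace-suc k (x ⊕ y) ⟩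
    trace k (x ⊕ y) ⊕ pow F (x ⊕ y) (2 ^ (k * m))             ≡⟨ cong₂ _⊕_ (trace-⊕ k x y) (frobenius (k * m) x y) ⟩
    (trace k x ⊕ trace k y) ⊕ (pow F x (2 ^ (k * m)) ⊕ pow F y (2 ^ (k * m)))
                                                              ≡⟨ ⊕-interchange (trace k x) (trace k y) _ _ ⟩
    (trace k x ⊕ pow F x (2 ^ (k * m))) ⊕ (trace k y ⊕ pow F y (2 ^ (k * m)))
                                                              ≡⟨ cong₂ _⊕_ (trace-suc k x) (trace-suc k y) ⟨
    trace (suc k) x ⊕ trace (suc k) y                         ∎
    where open ≡-Reasoning

  pow-2^[suc-k*m] : ∀ k x → pow F (pow F x (2 ^ (k * m))) (2 ^ m) ≡ pow F x (2 ^ (suc k * m))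
  pow-2^[suc-k*m] k x = begin
    pow F (pow F x (2 ^ (k * m))) (2 ^ m)     ≡⟨ pow-* x (2 ^ (k * m)) (2 ^ m) ⟨
    pow F x (2 ^ (k * m) * 2 ^ m)             ≡⟨ cong (pow F x) (ℕ.*-comm (2 ^ (k * m)) (2 ^ m)) ⟩
    pow F x (2 ^ m * 2 ^ (k * m))             ≡⟨ cong (pow F x) (ℕ.^-distribˡ-+-* 2 m (k * m)) ⟨
    pow F x (2 ^ (suc k * m))                 ∎
    where open ≡-Reasoning

  trace-telescopes : ∀ k x → pow F (trace k x) (2 ^ m) ⊕ x ≡ trace k x ⊕ pow F x (2 ^ (k * m))
  trace-telescopes zero    x = begin
    pow F 𝟎 (2 ^ m) ⊕ x        ≡⟨ cong (_⊕ x) (subfield-𝟎 m) ⟩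
    𝟎 ⊕ x                      ≡⟨ cong (𝟎 ⊕_) (⊛-identityʳ x) ⟨
    𝟎 ⊕ pow F x 1              ∎
    where open ≡-Reasoning
  trace-telescopes (suc k) x = begin
    pow F (trace (suc k) x) (2 ^ m) ⊕ x                        ≡⟨ cong (λ z → pow F z (2 ^ m) ⊕ x) (trace-suc k x) ⟩
    pow F (trace k x ⊕ X) (2 ^ m) ⊕ x                          ≡⟨ cong (_⊕ x) (frobenius m (trace k x) X) ⟩
    (pow F (trace k x) (2 ^ m) ⊕ pow F X (2 ^ m)) ⊕ x          ≡⟨ [x⊕y]⊕z≡[x⊕z]⊕y _ _ x ⟩
    (pow F (trace k x) (2 ^ m) ⊕ x) ⊕ pow F X (2 ^ m)          ≡⟨ cong₂ _⊕_ (trace-telescopes k x) (pow-2^[suc-k*m] k x) ⟩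
    (trace k x ⊕ X) ⊕ pow F x (2 ^ (suc k * m))                ≡⟨ cong (_⊕ pow F x (2 ^ (suc k * m))) (trace-suc k x) ⟨
    trace (suc k) x ⊕ pow F x (2 ^ (suc k * m))                ∎
    where
    open ≡-Reasoning
    X = pow F x (2 ^ (k * m))

  trace-∈-subfield : ∀ {k} → k * m ≡ n → ∀ x → InSubfield F m (trace k x)
  trace-∈-subfield {k} k*m≡n x = ⊕-cancelʳ x _ _ (begin
    pow F (trace k x) (2 ^ m) ⊕ x          ≡⟨ trace-telescopes k x ⟩
    trace k x ⊕ pow F x (2 ^ (k * m))      ≡⟨ cong (λ e → trace k x ⊕ pow F x (2 ^ e)) k*m≡n ⟩
    trace k x ⊕ pow F x (2 ^ n)            ≡⟨ cong (trace k x ⊕_) (fermat x) ⟩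
    trace k x ⊕ x                          ∎)
    where open ≡-Reasoning

  length-tracePoly : ∀ k → length (tracePoly (suc k)) ≡ suc (2 ^ (k * m))
  length-tracePoly zero    = refl
  length-tracePoly (suc k) = begin
    length (tracePoly (suc k) +ₚ monomial (2 ^ (suc k * m)))            ≡⟨ length-+ₚ (tracePoly (suc k)) _ ⟩
    length (tracePoly (suc k)) ⊔ length (monomial (2 ^ (suc k * m)))    ≡⟨ cong₂ _⊔_ (length-tracePoly k) (length-monomial _) ⟩
    suc (2 ^ (k * m)) ⊔ suc (2 ^ (suc k * m))                           ≡⟨ ℕ.m≤n⇒m⊔n≡n (s≤s (ℕ.^-monoʳ-≤ 2 (ℕ.m≤n+m (k * m) m))) ⟩
    suc (2 ^ (suc k * m))                                               ∎
    where open ≡-Reasoning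

  InSubfield? : Decidable (InSubfield F m)
  InSubfield? x = pow F x (2 ^ m) ≟ⱽ x

  subfield : List (V n)
  subfield = filter InSubfield? (vectors n)

  subfield-unique : Unique subfield
  subfield-unique = Uniqueₚ.filter⁺ InSubfield? (vectors-unique n)

  trace-2 : ∀ x → trace 2 x ≡ x ⊕ pow F x (2 ^ m)
  trace-2 x = begin
    trace 2 x                          ≡⟨ trace-suc 1 x ⟩
    trace 1 x ⊕ pow F x (2 ^ (1 * m))  ≡⟨ cong₂ (λ y e → y ⊕ pow F x (2 ^ e)) (eval-monomial 1 x) (ℕ.*-identityˡ m) ⟩
    pow F x 1 ⊕ pow F x (2 ^ m)        ≡⟨ cong (_⊕ pow F x (2 ^ m)) (⊛-identityʳ x) ⟩
    x ⊕ pow F x (2 ^ m)                ∎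
    where open ≡-Reasoning

  module _ .{{m≢0 : NonZero m}} where

    coeff₁-tracePoly : ∀ k → coeff (tracePoly (suc k)) 1 ≡ 𝟏
    coeff₁-tracePoly zero    = refl
    coeff₁-tracePoly (suc k) = begin
      coeff (tracePoly (suc k) +ₚ monomial (2 ^ (suc k * m))) 1               ≡⟨ coeff-+ₚ (tracePoly (suc k)) _ 1 ⟩
      coeff (tracePoly (suc k)) 1 ⊕ coeff (monomial (2 ^ (suc k * m))) 1      ≡⟨ cong₂ _⊕_ (coeff₁-tracePoly k) (coeff-monomial-≢ 1≢2^[suc-k*m]) ⟩
      𝟏 ⊕ 𝟎                                                                  ≡⟨ ⊕-identityʳ 𝟏 ⟩
      𝟏                                                                      ∎
      where
      open ≡-Reasoning
      1≢2^[suc-k*m] : 1 ≢ 2 ^ (suc k * m)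
      1≢2^[suc-k*m] = ℕ.<⇒≢ (ℕ.^-monoʳ-< 2 (s≤s (s≤s z≤n)) (ℕ.<-≤-trans (>-nonZero⁻¹ m) (ℕ.m≤m+n m (k * m))))

    kernel-trace-bound : ∀ k {rs} → Unique rs → All (λ r → trace (suc k) r ≡ 𝟎) rs → length rs ≤ 2 ^ (k * m)
    kernel-trace-bound k rs-unique rs-roots = ℕ.≤-pred (subst (_ <_) (length-tracePoly k)
      (roots-bound (tracePoly (suc k)) tracePoly≢𝟎 rs-unique rs-roots))
      where
      tracePoly≢𝟎 : ¬ IsZero (tracePoly (suc k))
      tracePoly≢𝟎 tracePoly≡𝟎 = 𝟏≢𝟎 (trans (sym (coeff₁-tracePoly k)) (IsZero⇒coeff≡𝟎 tracePoly≡𝟎 1))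

    length-subfield≤ : length subfield ≤ 2 ^ m
    length-subfield≤ = subst (length subfield ≤_) (cong (2 ^_) (ℕ.*-identityˡ m))
      (kernel-trace-bound 1 subfield-unique (All.tabulate trace-2≡𝟎))
      where
      trace-2≡𝟎 : ∀ {x} → x ∈ subfield → trace 2 x ≡ 𝟎
      trace-2≡𝟎 {x} x∈ = trans (trace-2 x)
        (trans (cong (x ⊕_) (proj₂ (∈-filter⁻ InSubfield? {xs = vectors n} x∈))) (⊕-self x))

    length-subfield≥ : ∀ {i} → suc i * m ≡ n → 2 ^ m ≤ length subfield
    length-subfield≥ {i} [1+i]*m≡n =
      ℕ.*-cancelʳ-≤ (2 ^ m) (length subfield) (2 ^ (i * m)) {{ℕ.m^n≢0 2 (i * m)}} (begin
      2 ^ m * 2 ^ (i * m)                 ≡⟨ ℕ.^-distribˡ-+-* 2 m (i * m) ⟨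
      2 ^ (suc i * m)                     ≡⟨ cong (2 ^_) [1+i]*m≡n ⟩
      2 ^ n                               ≤⟨ rank-nullity-bound (trace (suc i)) (trace-⊕ (suc i)) subfield-unique kernel-unique
                                               (λ x → ∈-filter⁺ InSubfield? (∈-vectors _) (trace-∈-subfield {suc i} [1+i]*m≡n x))
                                               (λ {x} x∈ker → ∈-filter⁺ (λ y → trace (suc i) y ≟ⱽ 𝟎) (∈-vectors x) x∈ker) ⟩
      length subfield * length kernel    ≤⟨ ℕ.*-monoʳ-≤ (length subfield) (kernel-trace-bound i kernel-unique
                                               (Allₚ.all-filter (λ y → trace (suc i) y ≟ⱽ 𝟎) (vectors n))) ⟩
      length subfield * 2 ^ (i * m)       ∎)
      where
      open ℕ.≤-Reasoning
      kernel : List (V n)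
      kernel = filter (λ y → trace (suc i) y ≟ⱽ 𝟎) (vectors n)
      kernel-unique : Unique kernel
      kernel-unique = Uniqueₚ.filter⁺ (λ y → trace (suc i) y ≟ⱽ 𝟎) (vectors-unique n)

    length-subfield : ∀ {i} → suc i * m ≡ n → length subfield ≡ 2 ^ m
    length-subfield {i} [1+i]*m≡n = ℕ.≤-antisym length-subfield≤ (length-subfield≥ {i} [1+i]*m≡n)

-- coordinates of a ⊕ b ⊕ c, the only nonzero point of the plane of a triangle on none of its lines
offTriangle : V 3
offTriangle = true ∷ true ∷ true ∷ []

standardTriangle : Triple 3
standardTriangle = true ∷ false ∷ false ∷ [] , false ∷ true ∷ false ∷ [] , false ∷ false ∷ true ∷ []

module _ {n : ℕ} where

  ≐-refl : {L : Sub n} → L ≐ L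
  ≐-refl x = id , id

  ≐-trans : {L₁ L₂ L₃ : Sub n} → L₁ ≐ L₂ → L₂ ≐ L₃ → L₁ ≐ L₃
  ≐-trans L₁≐L₂ L₂≐L₃ x = proj₁ (L₂≐L₃ x) ∘ proj₁ (L₁≐L₂ x) , proj₂ (L₁≐L₂ x) ∘ proj₂ (L₂≐L₃ x)

  LineOf-resp-≐ : ∀ (T : Triple n) {L L′} → LineOf T L → L′ ≐ L → LineOf T L′
  LineOf-resp-≐ T (inj₁ L≐)        L′≐L = inj₁ (≐-trans L′≐L L≐)
  LineOf-resp-≐ T (inj₂ (inj₁ L≐)) L′≐L = inj₂ (inj₁ (≐-trans L′≐L L≐))
  LineOf-resp-≐ T (inj₂ (inj₂ L≐)) L′≐L = inj₂ (inj₂ (≐-trans L′≐L L≐))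

  -- TriEq T T′ is, by definition, T ⊑ T′ × T′ ⊑ T.
  _⊑_ : Triple n → Triple n → Set
  (a , b , c) ⊑ T = LineOf T (Span2 a b) × LineOf T (Span2 b c) × LineOf T (Span2 c a)

  LineOf-⊑ : ∀ {T T′ L} → T ⊑ T′ → LineOf T L → LineOf T′ L
  LineOf-⊑ {T′ = T′} (ab , _ , _) (inj₁ L≐)        = LineOf-resp-≐ T′ ab L≐
  LineOf-⊑ {T′ = T′} (_ , bc , _) (inj₂ (inj₁ L≐)) = LineOf-resp-≐ T′ bc L≐
  LineOf-⊑ {T′ = T′} (_ , _ , ca) (inj₂ (inj₂ L≐)) = LineOf-resp-≐ T′ ca L≐

  ⊑-trans : ∀ {T₁ T₂ T₃} → T₁ ⊑ T₂ → T₂ ⊑ T₃ → T₁ ⊑ T₃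
  ⊑-trans (ab , bc , ca) T₂⊑T₃ = LineOf-⊑ T₂⊑T₃ ab , LineOf-⊑ T₂⊑T₃ bc , LineOf-⊑ T₂⊑T₃ ca

  TriEq-trans : ∀ {T₁ T₂ T₃} → TriEq T₁ T₂ → TriEq T₂ T₃ → TriEq T₁ T₃
  TriEq-trans (T₁⊑T₂ , T₂⊑T₁) (T₂⊑T₃ , T₃⊑T₂) = ⊑-trans T₁⊑T₂ T₂⊑T₃ , ⊑-trans T₃⊑T₂ T₂⊑T₁

  OnTriangle : Triple n → V n → Set
  OnTriangle (a , b , c) x = Span2 a b x ⊎ Span2 b c x ⊎ Span2 c a x

  LineOf⇒OnTriangle : ∀ T {L x} → LineOf T L → L x → OnTriangle T x
  LineOf⇒OnTriangle T (inj₁ L≐)        x∈L = inj₁ (proj₁ (L≐ _) x∈L)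
  LineOf⇒OnTriangle T (inj₂ (inj₁ L≐)) x∈L = inj₂ (inj₁ (proj₁ (L≐ _) x∈L))
  LineOf⇒OnTriangle T (inj₂ (inj₂ L≐)) x∈L = inj₂ (inj₂ (proj₁ (L≐ _) x∈L))

  OnTriangle-⊑ : ∀ {T T′ x} → T ⊑ T′ → OnTriangle T x → OnTriangle T′ x
  OnTriangle-⊑ {T′ = T′} (ab , _ , _) (inj₁ x∈)        = LineOf⇒OnTriangle T′ ab x∈
  OnTriangle-⊑ {T′ = T′} (_ , bc , _) (inj₂ (inj₁ x∈)) = LineOf⇒OnTriangle T′ bc x∈
  OnTriangle-⊑ {T′ = T′} (_ , _ , ca) (inj₂ (inj₂ x∈)) = LineOf⇒OnTriangle T′ ca x∈

  Indep2-intro : ∀ {u v : V n} → u ≢ 𝟎 → v ≢ 𝟎 → u ≢ v → Indep2 u v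
  Indep2-intro u≢𝟎 v≢𝟎 u≢v true  true  u⊕v≡𝟎 = ⊥-elim (u≢v (⊕-≡𝟎⇒≡ _ _ u⊕v≡𝟎))
  Indep2-intro u≢𝟎 v≢𝟎 u≢v true  false u⊕𝟎≡𝟎 = ⊥-elim (u≢𝟎 (trans (sym (⊕-identityʳ _)) u⊕𝟎≡𝟎))
  Indep2-intro u≢𝟎 v≢𝟎 u≢v false true  𝟎⊕v≡𝟎 = ⊥-elim (v≢𝟎 (trans (sym (⊕-identityˡ _)) 𝟎⊕v≡𝟎))
  Indep2-intro u≢𝟎 v≢𝟎 u≢v false false _     = refl , refl

  orderedBases : V n → V n → List (V n × V n)
  orderedBases p q = (p , q) ∷ (q , p) ∷ (p , p ⊕ q) ∷ (p ⊕ q , p) ∷ (q , p ⊕ q) ∷ (p ⊕ q , q) ∷ []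

  linePairs : Triple n → List (V n × V n)
  linePairs (a , b , c) = orderedBases a b ++ orderedBases b c ++ orderedBases c a

  Span2-swap : ∀ {u v : V n} → Span2 u v ≐ Span2 v u
  Span2-swap {u} {v} x = swap , swap
    where
    swap : ∀ {u v : V n} → Span2 u v x → Span2 v u x
    swap (inj₁ x≡𝟎)                = inj₁ x≡𝟎
    swap (inj₂ (inj₁ x≡u))         = inj₂ (inj₂ (inj₁ x≡u))
    swap (inj₂ (inj₂ (inj₁ x≡v)))  = inj₂ (inj₁ x≡v)
    swap {u} {v} (inj₂ (inj₂ (inj₂ x≡u⊕v))) = inj₂ (inj₂ (inj₂ (trans x≡u⊕v (⊕-comm u v))))

  Span2-shear : ∀ {u v : V n} → Span2 u (u ⊕ v) ≐ Span2 u v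
  Span2-shear {u} {v} x = to , from
    where
    to : Span2 u (u ⊕ v) x → Span2 u v x
    to (inj₁ x≡𝟎)                     = inj₁ x≡𝟎
    to (inj₂ (inj₁ x≡u))              = inj₂ (inj₁ x≡u)
    to (inj₂ (inj₂ (inj₁ x≡u⊕v)))     = inj₂ (inj₂ (inj₂ x≡u⊕v))
    to (inj₂ (inj₂ (inj₂ x≡u⊕[u⊕v]))) = inj₂ (inj₂ (inj₁ (trans x≡u⊕[u⊕v] (x⊕[x⊕y]≡y u v))))
    from : Span2 u v x → Span2 u (u ⊕ v) x
    from (inj₁ x≡𝟎)                 = inj₁ x≡𝟎
    from (inj₂ (inj₁ x≡u))          = inj₂ (inj₁ x≡u)
    from (inj₂ (inj₂ (inj₁ x≡v)))   = inj₂ (inj₂ (inj₂ (trans x≡v (sym (x⊕[x⊕y]≡y u v)))))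
    from (inj₂ (inj₂ (inj₂ x≡u⊕v))) = inj₂ (inj₂ (inj₁ x≡u⊕v))

  orderedBases-span : ∀ {p q u v : V n} → (u , v) ∈ orderedBases p q → Span2 u v ≐ Span2 p q
  orderedBases-span (here refl)                                  = ≐-refl
  orderedBases-span (there (here refl))                          = Span2-swap
  orderedBases-span (there (there (here refl)))                  = Span2-shear
  orderedBases-span (there (there (there (here refl))))          = ≐-trans Span2-swap Span2-shear
  orderedBases-span {p} {q} (there (there (there (there (here refl))))) =
    ≐-trans (subst (λ w → Span2 q w ≐ Span2 q p) (⊕-comm q p) Span2-shear) Span2-swap
  orderedBases-span {p} {q} (there (there (there (there (there (here refl)))))) =
    ≐-trans Span2-swap (≐-trans (subst (λ w → Span2 q w ≐ Span2 q p) (⊕-comm q p) Span2-shear) Span2-swap)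

  ∈-orderedBases : ∀ {p q u v : V n} → Span2 p q u → Span2 p q v → u ≢ 𝟎 → v ≢ 𝟎 → u ≢ v →
    (u , v) ∈ orderedBases p q
  ∈-orderedBases (inj₁ u≡𝟎) _ u≢𝟎 _ _ = ⊥-elim (u≢𝟎 u≡𝟎)
  ∈-orderedBases _ (inj₁ v≡𝟎) _ v≢𝟎 _ = ⊥-elim (v≢𝟎 v≡𝟎)
  ∈-orderedBases (inj₂ (inj₁ refl))         (inj₂ (inj₁ refl))         _ _ u≢v = ⊥-elim (u≢v refl)
  ∈-orderedBases (inj₂ (inj₁ refl))         (inj₂ (inj₂ (inj₁ refl)))  _ _ _   = here refl
  ∈-orderedBases (inj₂ (inj₂ (inj₁ refl)))  (inj₂ (inj₁ refl))         _ _ _   = there (here refl)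
  ∈-orderedBases (inj₂ (inj₁ refl))         (inj₂ (inj₂ (inj₂ refl)))  _ _ _   = there (there (here refl))
  ∈-orderedBases (inj₂ (inj₂ (inj₂ refl)))  (inj₂ (inj₁ refl))         _ _ _   = there (there (there (here refl)))
  ∈-orderedBases (inj₂ (inj₂ (inj₁ refl)))  (inj₂ (inj₂ (inj₂ refl)))  _ _ _   = there (there (there (there (here refl))))
  ∈-orderedBases (inj₂ (inj₂ (inj₂ refl)))  (inj₂ (inj₂ (inj₁ refl)))  _ _ _   = there (there (there (there (there (here refl)))))
  ∈-orderedBases (inj₂ (inj₂ (inj₁ refl)))  (inj₂ (inj₂ (inj₁ refl)))  _ _ u≢v = ⊥-elim (u≢v refl)
  ∈-orderedBases (inj₂ (inj₂ (inj₂ refl)))  (inj₂ (inj₂ (inj₂ refl)))  _ _ u≢v = ⊥-elim (u≢v refl)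

  linePairs-line : ∀ T {u v} → (u , v) ∈ linePairs T → LineOf T (Span2 u v)
  linePairs-line (a , b , c) uv∈ with ∈-++⁻ (orderedBases a b) uv∈
  ... | inj₁ uv∈ab = inj₁ (orderedBases-span uv∈ab)
  ... | inj₂ uv∈bc∪ca with ∈-++⁻ (orderedBases b c) uv∈bc∪ca
  ...   | inj₁ uv∈bc = inj₂ (inj₁ (orderedBases-span uv∈bc))
  ...   | inj₂ uv∈ca = inj₂ (inj₂ (orderedBases-span uv∈ca))

  ∈-linePairs : ∀ T {L u v} → LineOf T L → L u → L v → u ≢ 𝟎 → v ≢ 𝟎 → u ≢ v → (u , v) ∈ linePairs T
  ∈-linePairs (a , b , c) (inj₁ L≐) u∈L v∈L u≢𝟎 v≢𝟎 u≢v =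
    ∈-++⁺ˡ (∈-orderedBases (proj₁ (L≐ _) u∈L) (proj₁ (L≐ _) v∈L) u≢𝟎 v≢𝟎 u≢v)
  ∈-linePairs (a , b , c) (inj₂ (inj₁ L≐)) u∈L v∈L u≢𝟎 v≢𝟎 u≢v =
    ∈-++⁺ʳ (orderedBases a b) (∈-++⁺ˡ (∈-orderedBases (proj₁ (L≐ _) u∈L) (proj₁ (L≐ _) v∈L) u≢𝟎 v≢𝟎 u≢v))
  ∈-linePairs (a , b , c) (inj₂ (inj₂ L≐)) u∈L v∈L u≢𝟎 v≢𝟎 u≢v =
    ∈-++⁺ʳ (orderedBases a b) (∈-++⁺ʳ (orderedBases b c)
      (∈-orderedBases (proj₁ (L≐ _) u∈L) (proj₁ (L≐ _) v∈L) u≢𝟎 v≢𝟎 u≢v))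

  module _ (h : V n → V n) (h-⊕ : ∀ x y → h (x ⊕ y) ≡ h x ⊕ h y) where

    map-orderedBases : ∀ p q → map (×-map h h) (orderedBases p q) ≡ orderedBases (h p) (h q)
    map-orderedBases p q =
      cong (λ r → (h p , h q) ∷ (h q , h p) ∷ (h p , r) ∷ (r , h p) ∷ (h q , r) ∷ (r , h q) ∷ []) (h-⊕ p q)

    map-linePairs : ∀ a b c → map (×-map h h) (linePairs (a , b , c)) ≡ linePairs (h a , h b , h c)
    map-linePairs a b c = begin
      map (×-map h h) (orderedBases a b ++ orderedBases b c ++ orderedBases c a)
        ≡⟨ map-++ (×-map h h) (orderedBases a b) _ ⟩
      map (×-map h h) (orderedBases a b) ++ map (×-map h h) (orderedBases b c ++ orderedBases c a)
        ≡⟨ cong (map (×-map h h) (orderedBases a b) ++_) (map-++ (×-map h h) (orderedBases b c) _) ⟩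
      map (×-map h h) (orderedBases a b) ++ map (×-map h h) (orderedBases b c) ++ map (×-map h h) (orderedBases c a)
        ≡⟨ cong₂ _++_ (map-orderedBases a b) (cong₂ _++_ (map-orderedBases b c) (map-orderedBases c a)) ⟩
      orderedBases (h a) (h b) ++ orderedBases (h b) (h c) ++ orderedBases (h c) (h a)  ∎
      where open ≡-Reasoning

  -- Defined point by point rather than as ((e₁ · a) ⊕ (e₂ · b)) ⊕ (e₃ · c) (see combination-linear),
  -- so that the points of the three lines, and hence linePairs T, are computed definitionally.
  combination : Triple n → V 3 → V n
  combination (a , b , c) (false ∷ false ∷ false ∷ []) = 𝟎
  combination (a , b , c) (true  ∷ false ∷ false ∷ []) = a
  combination (a , b , c) (false ∷ true  ∷ false ∷ []) = b
  combination (a , b , c) (false ∷ false ∷ true  ∷ []) = c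
  combination (a , b , c) (true  ∷ true  ∷ false ∷ []) = a ⊕ b
  combination (a , b , c) (false ∷ true  ∷ true  ∷ []) = b ⊕ c
  combination (a , b , c) (true  ∷ false ∷ true  ∷ []) = c ⊕ a
  combination (a , b , c) (true  ∷ true  ∷ true  ∷ []) = (a ⊕ b) ⊕ c

  combination-linear : ∀ a b c e₁ e₂ e₃ →
    combination (a , b , c) (e₁ ∷ e₂ ∷ e₃ ∷ []) ≡ ((e₁ · a) ⊕ (e₂ · b)) ⊕ (e₃ · c)
  combination-linear a b c false false false = sym (trans (⊕-identityʳ (𝟎 ⊕ 𝟎)) (⊕-self 𝟎))
  combination-linear a b c true  false false = sym (trans (⊕-identityʳ (a ⊕ 𝟎)) (⊕-identityʳ a))
  combination-linear a b c false true  false = sym (trans (⊕-identityʳ (𝟎 ⊕ b)) (⊕-identityˡ b))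
  combination-linear a b c false false true  = sym (trans (cong (_⊕ c) (⊕-self 𝟎)) (⊕-identityˡ c))
  combination-linear a b c true  true  false = sym (⊕-identityʳ (a ⊕ b))
  combination-linear a b c false true  true  = sym (cong (_⊕ c) (⊕-identityˡ b))
  combination-linear a b c true  false true  = sym (trans (cong (_⊕ c) (⊕-identityʳ a)) (⊕-comm a c))
  combination-linear a b c true  true  true  = refl

  ·-⊕ : ∀ e f (x : V n) → (e · x) ⊕ (f · x) ≡ (e xor f) · x
  ·-⊕ true  true  x = ⊕-self x
  ·-⊕ true  false x = ⊕-identityʳ x
  ·-⊕ false true  x = ⊕-identityˡ x
  ·-⊕ false false x = ⊕-self 𝟎

  combination-⊕ : ∀ T α β → combination T (α ⊕ β) ≡ combination T α ⊕ combination T β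
  combination-⊕ (a , b , c) (e₁ ∷ e₂ ∷ e₃ ∷ []) (f₁ ∷ f₂ ∷ f₃ ∷ []) = begin
    combination (a , b , c) ((e₁ xor f₁) ∷ (e₂ xor f₂) ∷ (e₃ xor f₃) ∷ [])
      ≡⟨ combination-linear a b c (e₁ xor f₁) (e₂ xor f₂) (e₃ xor f₃) ⟩
    (((e₁ xor f₁) · a) ⊕ ((e₂ xor f₂) · b)) ⊕ ((e₃ xor f₃) · c)
      ≡⟨ cong₂ _⊕_ (cong₂ _⊕_ (·-⊕ e₁ f₁ a) (·-⊕ e₂ f₂ b)) (·-⊕ e₃ f₃ c) ⟨
    (((e₁ · a) ⊕ (f₁ · a)) ⊕ ((e₂ · b) ⊕ (f₂ · b))) ⊕ ((e₃ · c) ⊕ (f₃ · c))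
      ≡⟨ cong (_⊕ ((e₃ · c) ⊕ (f₃ · c))) (⊕-interchange (e₁ · a) (f₁ · a) (e₂ · b) (f₂ · b)) ⟩
    (((e₁ · a) ⊕ (e₂ · b)) ⊕ ((f₁ · a) ⊕ (f₂ · b))) ⊕ ((e₃ · c) ⊕ (f₃ · c))
      ≡⟨ ⊕-interchange ((e₁ · a) ⊕ (e₂ · b)) ((f₁ · a) ⊕ (f₂ · b)) (e₃ · c) (f₃ · c) ⟩
    (((e₁ · a) ⊕ (e₂ · b)) ⊕ (e₃ · c)) ⊕ (((f₁ · a) ⊕ (f₂ · b)) ⊕ (f₃ · c))
      ≡⟨ cong₂ _⊕_ (combination-linear a b c e₁ e₂ e₃) (combination-linear a b c f₁ f₂ f₃) ⟨
    combination (a , b , c) (e₁ ∷ e₂ ∷ e₃ ∷ []) ⊕ combination (a , b , c) (f₁ ∷ f₂ ∷ f₃ ∷ [])  ∎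
    where open ≡-Reasoning

  combination-injective : ∀ {T} → Indep3 T → ∀ {α β} → combination T α ≡ combination T β → α ≡ β
  combination-injective {T@(a , b , c)} indep {α} {β} α≡β = ⊕-≡𝟎⇒≡ α β (α⊕β≡𝟎 (α ⊕ β) (begin
    combination T (α ⊕ β)                    ≡⟨ combination-⊕ T α β ⟩
    combination T α ⊕ combination T β        ≡⟨ cong (_⊕ combination T β) α≡β ⟩
    combination T β ⊕ combination T β        ≡⟨ ⊕-self (combination T β) ⟩
    𝟎                                        ∎))
    where
    open ≡-Reasoning
    α⊕β≡𝟎 : ∀ γ → combination T γ ≡ 𝟎 → γ ≡ 𝟎
    α⊕β≡𝟎 (e₁ ∷ e₂ ∷ e₃ ∷ []) γ≡𝟎 with indep e₁ e₂ e₃ (trans (sym (combination-linear a b c e₁ e₂ e₃)) γ≡𝟎)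
    ... | refl , refl , refl = refl

  combination-map : (h : V n → V n) → h 𝟎 ≡ 𝟎 → (∀ x y → h (x ⊕ y) ≡ h x ⊕ h y) →
    ∀ a b c α → combination (h a , h b , h c) α ≡ h (combination (a , b , c) α)
  combination-map h h𝟎 h-⊕ a b c (false ∷ false ∷ false ∷ []) = sym h𝟎
  combination-map h h𝟎 h-⊕ a b c (true  ∷ false ∷ false ∷ []) = refl
  combination-map h h𝟎 h-⊕ a b c (false ∷ true  ∷ false ∷ []) = refl
  combination-map h h𝟎 h-⊕ a b c (false ∷ false ∷ true  ∷ []) = refl
  combination-map h h𝟎 h-⊕ a b c (true  ∷ true  ∷ false ∷ []) = sym (h-⊕ a b)
  combination-map h h𝟎 h-⊕ a b c (false ∷ true  ∷ true  ∷ []) = sym (h-⊕ b c)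
  combination-map h h𝟎 h-⊕ a b c (true  ∷ false ∷ true  ∷ []) = sym (h-⊕ c a)
  combination-map h h𝟎 h-⊕ a b c (true  ∷ true  ∷ true  ∷ []) =
    sym (trans (h-⊕ (a ⊕ b) c) (cong (_⊕ h c) (h-⊕ a b)))

  OnTriangle⇒combination : ∀ T {x} → OnTriangle T x → Σ (V 3) λ α → x ≡ combination T α × α ≢ offTriangle
  OnTriangle⇒combination _ (inj₁ (inj₁ x≡𝟎))                       = 𝟎 , x≡𝟎 , λ ()
  OnTriangle⇒combination _ (inj₁ (inj₂ (inj₁ x≡a)))                = (true ∷ false ∷ false ∷ []) , x≡a , λ ()
  OnTriangle⇒combination _ (inj₁ (inj₂ (inj₂ (inj₁ x≡b))))         = (false ∷ true ∷ false ∷ []) , x≡b , λ ()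
  OnTriangle⇒combination _ (inj₁ (inj₂ (inj₂ (inj₂ x≡a⊕b))))       = (true ∷ true ∷ false ∷ []) , x≡a⊕b , λ ()
  OnTriangle⇒combination _ (inj₂ (inj₁ (inj₁ x≡𝟎)))                = 𝟎 , x≡𝟎 , λ ()
  OnTriangle⇒combination _ (inj₂ (inj₁ (inj₂ (inj₁ x≡b))))         = (false ∷ true ∷ false ∷ []) , x≡b , λ ()
  OnTriangle⇒combination _ (inj₂ (inj₁ (inj₂ (inj₂ (inj₁ x≡c)))))  = (false ∷ false ∷ true ∷ []) , x≡c , λ ()
  OnTriangle⇒combination _ (inj₂ (inj₁ (inj₂ (inj₂ (inj₂ x≡b⊕c))))) = (false ∷ true ∷ true ∷ []) , x≡b⊕c , λ ()
  OnTriangle⇒combination _ (inj₂ (inj₂ (inj₁ x≡𝟎)))                = 𝟎 , x≡𝟎 , λ ()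
  OnTriangle⇒combination _ (inj₂ (inj₂ (inj₂ (inj₁ x≡c))))         = (false ∷ false ∷ true ∷ []) , x≡c , λ ()
  OnTriangle⇒combination _ (inj₂ (inj₂ (inj₂ (inj₂ (inj₁ x≡a)))))  = (true ∷ false ∷ false ∷ []) , x≡a , λ ()
  OnTriangle⇒combination _ (inj₂ (inj₂ (inj₂ (inj₂ (inj₂ x≡c⊕a))))) = (true ∷ false ∷ true ∷ []) , x≡c⊕a , λ ()

  combination⇒OnTriangle : ∀ T α → α ≢ 𝟎 → α ≢ offTriangle → OnTriangle T (combination T α)
  combination⇒OnTriangle _ (false ∷ false ∷ false ∷ []) α≢𝟎 _ = ⊥-elim (α≢𝟎 refl)
  combination⇒OnTriangle _ (true  ∷ false ∷ false ∷ []) _ _ = inj₁ (inj₂ (inj₁ refl))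
  combination⇒OnTriangle _ (false ∷ true  ∷ false ∷ []) _ _ = inj₁ (inj₂ (inj₂ (inj₁ refl)))
  combination⇒OnTriangle _ (false ∷ false ∷ true  ∷ []) _ _ = inj₂ (inj₁ (inj₂ (inj₂ (inj₁ refl))))
  combination⇒OnTriangle _ (true  ∷ true  ∷ false ∷ []) _ _ = inj₁ (inj₂ (inj₂ (inj₂ refl)))
  combination⇒OnTriangle _ (false ∷ true  ∷ true  ∷ []) _ _ = inj₂ (inj₁ (inj₂ (inj₂ (inj₂ refl))))
  combination⇒OnTriangle _ (true  ∷ false ∷ true  ∷ []) _ _ = inj₂ (inj₂ (inj₂ (inj₂ (inj₂ refl))))
  combination⇒OnTriangle _ (true  ∷ true  ∷ true  ∷ []) _ α≢offTriangle = ⊥-elim (α≢offTriangle refl)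

  NonzeroDistinct : V n × V n → Set
  NonzeroDistinct (u , v) = u ≢ 𝟎 × v ≢ 𝟎 × u ≢ v

  nonzeroDistinct? : Decidable NonzeroDistinct
  nonzeroDistinct? (u , v) = ¬? (u ≟ⱽ 𝟎) ×-dec ¬? (v ≟ⱽ 𝟎) ×-dec ¬? (u ≟ⱽ v)

module _ {n : ℕ} where

  -- Both lemmas use that linePairs T is, by definition of combination, the image of
  -- linePairs standardTriangle under combination T, where the claims are decided.
  linePairs-unique : ∀ {T : Triple n} → Indep3 T → Unique (linePairs T)
  linePairs-unique {T} indep = Uniqueₚ.map⁺ combination²-injective
    (from-yes (unique? (×-≡-dec _≟ⱽ_ _≟ⱽ_) (linePairs standardTriangle)))
    where
    combination²-injective : ∀ {p q} → ×-map (combination T) (combination T) p ≡ ×-map (combination T) (combination T) q → p ≡ q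
    combination²-injective eq with ×-≡,≡←≡ eq
    ... | α≡α′ , β≡β′ = cong₂ _,_ (combination-injective indep α≡α′) (combination-injective indep β≡β′)

  linePairs-nonzeroDistinct : ∀ {T : Triple n} → Indep3 T → All NonzeroDistinct (linePairs T)
  linePairs-nonzeroDistinct {T} indep = Allₚ.map⁺
    (All.map transfer (from-yes (All.all? nonzeroDistinct? (linePairs standardTriangle))))
    where
    nonzero : ∀ {α} → α ≢ 𝟎 → combination T α ≢ 𝟎
    nonzero {α} α≢𝟎 = α≢𝟎 ∘ combination-injective indep {β = 𝟎}
    transfer : ∀ {p} → NonzeroDistinct p → NonzeroDistinct (×-map (combination T) (combination T) p)
    transfer (α≢𝟎 , β≢𝟎 , α≢β) = nonzero α≢𝟎 , nonzero β≢𝟎 , α≢β ∘ combination-injective indep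

module Triangles {n : ℕ} (F : FieldOn n) where
  open FieldOn F
  open FieldTheory F

  scale : V n → Triple n → Triple n
  scale s (a , b , c) = s ⊛ a , s ⊛ b , s ⊛ c

  Span2-scale : ∀ s {p q x} → Span2 p q x → Span2 (s ⊛ p) (s ⊛ q) (s ⊛ x)
  Span2-scale s (inj₁ refl)                        = inj₁ (⊛-zeroʳ s)
  Span2-scale s (inj₂ (inj₁ refl))                 = inj₂ (inj₁ refl)
  Span2-scale s (inj₂ (inj₂ (inj₁ refl)))          = inj₂ (inj₂ (inj₁ refl))
  Span2-scale s {p} {q} (inj₂ (inj₂ (inj₂ refl)))  = inj₂ (inj₂ (inj₂ (⊛-distribˡ s p q)))

  Span2-unscale : ∀ {s p q x} → s ≢ 𝟎 → Span2 (s ⊛ p) (s ⊛ q) (s ⊛ x) → Span2 p q x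
  Span2-unscale s≢𝟎 (inj₁ sx≡𝟎)                 = inj₁ (⊛≡𝟎⇒≡𝟎 s≢𝟎 sx≡𝟎)
  Span2-unscale s≢𝟎 (inj₂ (inj₁ sx≡sp))         = inj₂ (inj₁ (⊛-cancelˡ s≢𝟎 sx≡sp))
  Span2-unscale s≢𝟎 (inj₂ (inj₂ (inj₁ sx≡sq)))  = inj₂ (inj₂ (inj₁ (⊛-cancelˡ s≢𝟎 sx≡sq)))
  Span2-unscale {s} {p} {q} s≢𝟎 (inj₂ (inj₂ (inj₂ sx≡sp⊕sq))) =
    inj₂ (inj₂ (inj₂ (⊛-cancelˡ s≢𝟎 (trans sx≡sp⊕sq (sym (⊛-distribˡ s p q))))))

  Span2-scale-⊆ : ∀ {s u v p q} → s ≢ 𝟎 → (∀ {x} → Span2 u v x → Span2 p q x) →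
    ∀ {y} → Span2 (s ⊛ u) (s ⊛ v) y → Span2 (s ⊛ p) (s ⊛ q) y
  Span2-scale-⊆ {s} s≢𝟎 uv⊆pq {y} y∈ = subst (Span2 _ _) (x⊛[x⁻¹⊛y]≡y y s≢𝟎)
    (Span2-scale s (uv⊆pq (Span2-unscale s≢𝟎 (subst (Span2 _ _) (sym (x⊛[x⁻¹⊛y]≡y y s≢𝟎)) y∈))))

  Span2-scale-≐ : ∀ {s u v p q} → s ≢ 𝟎 → Span2 u v ≐ Span2 p q →
    Span2 (s ⊛ u) (s ⊛ v) ≐ Span2 (s ⊛ p) (s ⊛ q)
  Span2-scale-≐ s≢𝟎 uv≐pq y = Span2-scale-⊆ s≢𝟎 (proj₁ (uv≐pq _)) , Span2-scale-⊆ s≢𝟎 (proj₂ (uv≐pq _))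

  LineOf-scale : ∀ {s T u v} → s ≢ 𝟎 → LineOf T (Span2 u v) → LineOf (scale s T) (Span2 (s ⊛ u) (s ⊛ v))
  LineOf-scale s≢𝟎 (inj₁ uv≐)        = inj₁ (Span2-scale-≐ s≢𝟎 uv≐)
  LineOf-scale s≢𝟎 (inj₂ (inj₁ uv≐)) = inj₂ (inj₁ (Span2-scale-≐ s≢𝟎 uv≐))
  LineOf-scale s≢𝟎 (inj₂ (inj₂ uv≐)) = inj₂ (inj₂ (Span2-scale-≐ s≢𝟎 uv≐))

  OnTriangle-unscale : ∀ {s T x} → s ≢ 𝟎 → OnTriangle (scale s T) (s ⊛ x) → OnTriangle T x
  OnTriangle-unscale s≢𝟎 (inj₁ sx∈)        = inj₁ (Span2-unscale s≢𝟎 sx∈)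
  OnTriangle-unscale s≢𝟎 (inj₂ (inj₁ sx∈)) = inj₂ (inj₁ (Span2-unscale s≢𝟎 sx∈))
  OnTriangle-unscale s≢𝟎 (inj₂ (inj₂ sx∈)) = inj₂ (inj₂ (Span2-unscale s≢𝟎 sx∈))

  combination-scale : ∀ s T α → combination (scale s T) α ≡ s ⊛ combination T α
  combination-scale s (a , b , c) = combination-map (s ⊛_) (⊛-zeroʳ s) (⊛-distribˡ s) a b c

  Indep3-scale : ∀ {s T} → s ≢ 𝟎 → Indep3 T → Indep3 (scale s T)
  Indep3-scale {s} {T@(a , b , c)} s≢𝟎 indep e₁ e₂ e₃ sT-relation = indep e₁ e₂ e₃ (begin
    ((e₁ · a) ⊕ (e₂ · b)) ⊕ (e₃ · c)                    ≡⟨ combination-linear a b c e₁ e₂ e₃ ⟨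
    combination T α                                     ≡⟨ ⊛≡𝟎⇒≡𝟎 s≢𝟎 (begin
      s ⊛ combination T α                                 ≡⟨ combination-scale s T α ⟨
      combination (scale s T) α                           ≡⟨ combination-linear (s ⊛ a) (s ⊛ b) (s ⊛ c) e₁ e₂ e₃ ⟩
      ((e₁ · (s ⊛ a)) ⊕ (e₂ · (s ⊛ b))) ⊕ (e₃ · (s ⊛ c))  ≡⟨ sT-relation ⟩
      𝟎                                                   ∎) ⟩
    𝟎                                                   ∎)
    where
    open ≡-Reasoning
    α = e₁ ∷ e₂ ∷ e₃ ∷ []

  scale-stabiliser : ∀ {T s} → Indep3 T → s ≢ 𝟎 → TriEq T (scale s T) → s ≡ 𝟏
  scale-stabiliser {T@(a , b , c)} {s} indep s≢𝟎 (T⊑sT , sT⊑T) = by-cases (δ ≟ⱽ offTriangle)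
    where
    open ≡-Reasoning
    w = (a ⊕ b) ⊕ c

    w≢𝟎 : w ≢ 𝟎
    w≢𝟎 w≡𝟎 with combination-injective indep {offTriangle} {𝟎} w≡𝟎
    ... | ()

    coordinates : ∀ {x} → OnTriangle T x → V 3
    coordinates x-on-T = proj₁ (OnTriangle⇒combination T x-on-T)

    coordinates-correct : ∀ {x} (x-on-T : OnTriangle T x) → x ≡ combination T (coordinates x-on-T)
    coordinates-correct x-on-T = proj₁ (proj₂ (OnTriangle⇒combination T x-on-T))

    sa-on = OnTriangle-⊑ sT⊑T (inj₁ (inj₂ (inj₁ refl)))
    sb-on = OnTriangle-⊑ sT⊑T (inj₁ (inj₂ (inj₂ (inj₁ refl))))
    sc-on = OnTriangle-⊑ sT⊑T (inj₂ (inj₁ (inj₂ (inj₂ (inj₁ refl)))))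
    α = coordinates sa-on
    β = coordinates sb-on
    γ = coordinates sc-on
    δ = (α ⊕ β) ⊕ γ

    sw≡δ : s ⊛ w ≡ combination T δ
    sw≡δ = begin
      s ⊛ ((a ⊕ b) ⊕ c)                                     ≡⟨ ⊛-distribˡ s (a ⊕ b) c ⟩
      (s ⊛ (a ⊕ b)) ⊕ (s ⊛ c)                               ≡⟨ cong (_⊕ (s ⊛ c)) (⊛-distribˡ s a b) ⟩
      ((s ⊛ a) ⊕ (s ⊛ b)) ⊕ (s ⊛ c)                         ≡⟨ cong₂ _⊕_ (cong₂ _⊕_ (coordinates-correct sa-on)
                                                                (coordinates-correct sb-on)) (coordinates-correct sc-on) ⟩
      (combination T α ⊕ combination T β) ⊕ combination T γ ≡⟨ cong (_⊕ combination T γ) (combination-⊕ T α β) ⟨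
      combination T (α ⊕ β) ⊕ combination T γ               ≡⟨ combination-⊕ T (α ⊕ β) γ ⟨
      combination T δ                                       ∎

    by-cases : Dec (δ ≡ offTriangle) → s ≡ 𝟏
    by-cases (yes δ≡offTriangle) = ⊛-cancelˡ w≢𝟎 (begin
      w ⊛ s              ≡⟨ ⊛-comm w s ⟩
      s ⊛ w              ≡⟨ sw≡δ ⟩
      combination T δ    ≡⟨ cong (combination T) δ≡offTriangle ⟩
      w                  ≡⟨ ⊛-identityʳ w ⟨
      w ⊛ 𝟏              ∎)
    by-cases (no δ≢offTriangle) = ⊥-elim (proj₂ (proj₂ (OnTriangle⇒combination T w-on-T))
      (sym (combination-injective indep (coordinates-correct w-on-T))))
      where
      δ≢𝟎 : δ ≢ 𝟎
      δ≢𝟎 δ≡𝟎 = ⊛-nonzero s≢𝟎 w≢𝟎 (trans sw≡δ (cong (combination T) δ≡𝟎))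
      w-on-T : OnTriangle T w
      w-on-T = OnTriangle-unscale s≢𝟎 (OnTriangle-⊑ T⊑sT
        (subst (OnTriangle T) (sym sw≡δ) (combination⇒OnTriangle T δ δ≢𝟎 δ≢offTriangle)))

  ratio : V n × V n → V n
  ratio (u , v) = v ⊛ u ⁻¹

  ratios : Triple n → List (V n)
  ratios T = map ratio (linePairs T)

  ratio-scale : ∀ {s} → s ≢ 𝟎 → ∀ p → ratio (×-map (s ⊛_) (s ⊛_) p) ≡ ratio p
  ratio-scale {s} s≢𝟎 (u , v) = begin
    (s ⊛ v) ⊛ (s ⊛ u) ⁻¹           ≡⟨ cong ((s ⊛ v) ⊛_) (⁻¹-distrib-⊛ u s≢𝟎) ⟩
    (s ⊛ v) ⊛ (s ⁻¹ ⊛ u ⁻¹)        ≡⟨ ⊛-interchange s v (s ⁻¹) (u ⁻¹) ⟩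
    (s ⊛ s ⁻¹) ⊛ (v ⊛ u ⁻¹)        ≡⟨ cong (_⊛ (v ⊛ u ⁻¹)) (⊛-inverseʳ s≢𝟎) ⟩
    𝟏 ⊛ (v ⊛ u ⁻¹)                 ≡⟨ ⊛-identityˡ (v ⊛ u ⁻¹) ⟩
    v ⊛ u ⁻¹                       ∎
    where open ≡-Reasoning

  ratios-scale : ∀ {s} → s ≢ 𝟎 → ∀ T → ratios (scale s T) ≡ ratios T
  ratios-scale {s} s≢𝟎 T@(a , b , c) = begin
    map ratio (linePairs (scale s T))                              ≡⟨ cong (map ratio) (map-linePairs (s ⊛_) (⊛-distribˡ s) a b c) ⟨
    map ratio (map (×-map (s ⊛_) (s ⊛_)) (linePairs T))            ≡⟨ map-∘ {g = ratio} {f = ×-map (s ⊛_) (s ⊛_)} (linePairs T) ⟨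
    map (ratio ∘ ×-map (s ⊛_) (s ⊛_)) (linePairs T)                ≡⟨ map-cong (ratio-scale s≢𝟎) (linePairs T) ⟩
    map ratio (linePairs T)                                        ∎
    where open ≡-Reasoning

  ratios-⊑ : ∀ {T T′} → Indep3 T → T ⊑ T′ → ∀ {z} → z ∈ ratios T → z ∈ ratios T′
  ratios-⊑ {T} {T′} indep T⊑T′ z∈ with ∈-map⁻ ratio z∈
  ... | (u , v) , uv∈ , refl = ∈-map⁺ ratio (∈-linePairs T′ (LineOf-⊑ T⊑T′ (linePairs-line T uv∈))
    (inj₂ (inj₁ refl)) (inj₂ (inj₂ (inj₁ refl))) u≢𝟎 v≢𝟎 u≢v)
    where
    u≢𝟎 = proj₁ (All.lookup (linePairs-nonzeroDistinct indep) uv∈)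
    v≢𝟎 = proj₁ (proj₂ (All.lookup (linePairs-nonzeroDistinct indep) uv∈))
    u≢v = proj₂ (proj₂ (All.lookup (linePairs-nonzeroDistinct indep) uv∈))

  same-ratio⇒scaled : ∀ {u v u′ v′} → u ≢ 𝟎 → u′ ≢ 𝟎 → ratio (u , v) ≡ ratio (u′ , v′) →
    ∃ λ s → s ≢ 𝟎 × s ⊛ u ≡ u′ × s ⊛ v ≡ v′
  same-ratio⇒scaled {u} {v} {u′} {v′} u≢𝟎 u′≢𝟎 same = s , ⊛-nonzero u′≢𝟎 (⁻¹-nonzero u≢𝟎) , su≡u′ , sv≡v′
    where
    open ≡-Reasoning
    s = u′ ⊛ u ⁻¹
    su≡u′ : s ⊛ u ≡ u′
    su≡u′ = begin
      (u′ ⊛ u ⁻¹) ⊛ u     ≡⟨ ⊛-assoc u′ (u ⁻¹) u ⟩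
      u′ ⊛ (u ⁻¹ ⊛ u)     ≡⟨ cong (u′ ⊛_) (⊛-inverseˡ u≢𝟎) ⟩
      u′ ⊛ 𝟏              ≡⟨ ⊛-identityʳ u′ ⟩
      u′                  ∎
    sv≡v′ : s ⊛ v ≡ v′
    sv≡v′ = begin
      (u′ ⊛ u ⁻¹) ⊛ v     ≡⟨ ⊛-assoc u′ (u ⁻¹) v ⟩
      u′ ⊛ (u ⁻¹ ⊛ v)     ≡⟨ cong (u′ ⊛_) (⊛-comm (u ⁻¹) v) ⟩
      u′ ⊛ (v ⊛ u ⁻¹)     ≡⟨ cong (u′ ⊛_) same ⟩
      u′ ⊛ (v′ ⊛ u′ ⁻¹)   ≡⟨ cong (u′ ⊛_) (⊛-comm v′ (u′ ⁻¹)) ⟩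
      u′ ⊛ (u′ ⁻¹ ⊛ v′)   ≡⟨ x⊛[x⁻¹⊛y]≡y v′ u′≢𝟎 ⟩
      v′                  ∎

module Design {n : ℕ} {F : FieldOn n} {m : ℕ} {B : Triple n → Set}
              (D : IsInvariantDesarguesianGDTD F m B) where
  open FieldOn F
  open FieldTheory F
  open Triangles F
  open SubfieldSize F m using (InSubfield?)
  open IsInvariantDesarguesianGDTD D

  block-unique : ∀ {u v T T′} → Indep2 u v → B T → B T′ →
    LineOf T (Span2 u v) → LineOf T′ (Span2 u v) → TriEq T T′
  block-unique {u} {v} uv-indep BT BT′ uv∈T uv∈T′ with lines-covered u v uv-indep
  ... | inj₁ ((_ , unique) , _) = unique _ _ BT BT′ uv∈T uv∈T′
  ... | inj₂ (no-block , _)     = ⊥-elim (no-block _ BT uv∈T)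

  block-transport : ∀ {s T T′ u v} → B T → B T′ → s ≢ 𝟎 → (u , v) ∈ linePairs T →
    LineOf T′ (Span2 (s ⊛ u) (s ⊛ v)) → TriEq T′ (scale s T)
  block-transport {s} {T@(a , b , c)} BT BT′ s≢𝟎 uv∈ suv∈T′ with mult-invariant s s≢𝟎 a b c BT
  ... | T″ , BT″ , T″≡sT = TriEq-trans (block-unique suv-indep BT′ BT″ suv∈T′ suv∈T″) T″≡sT
    where
    uv-distinct = All.lookup (linePairs-nonzeroDistinct (blocks-are-triangles T BT)) uv∈
    suv-indep = Indep2-intro (⊛-nonzero s≢𝟎 (proj₁ uv-distinct)) (⊛-nonzero s≢𝟎 (proj₁ (proj₂ uv-distinct)))
      (proj₂ (proj₂ uv-distinct) ∘ ⊛-cancelˡ s≢𝟎)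
    suv∈T″ = LineOf-⊑ (proj₂ T″≡sT) (LineOf-scale s≢𝟎 (linePairs-line T uv∈))

  ratios-unique : ∀ {T} → B T → Unique (ratios T)
  ratios-unique {T} BT = Unique-map⁺ ratio-injective (linePairs-unique indep)
    where
    indep = blocks-are-triangles T BT
    ratio-injective : ∀ {p q} → p ∈ linePairs T → q ∈ linePairs T → ratio p ≡ ratio q → p ≡ q
    ratio-injective {u , v} {u′ , v′} p∈ q∈ same = cong₂ _,_ (unscaled su≡u′) (unscaled sv≡v′)
      where
      scaled = same-ratio⇒scaled (proj₁ (All.lookup (linePairs-nonzeroDistinct indep) p∈))
                                 (proj₁ (All.lookup (linePairs-nonzeroDistinct indep) q∈)) same
      s = proj₁ scaled
      s≢𝟎 = proj₁ (proj₂ scaled)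
      su≡u′ = proj₁ (proj₂ (proj₂ scaled))
      sv≡v′ = proj₂ (proj₂ (proj₂ scaled))
      s≡𝟏 : s ≡ 𝟏
      s≡𝟏 = scale-stabiliser indep s≢𝟎 (block-transport BT BT s≢𝟎 p∈
        (subst₂ (λ x y → LineOf T (Span2 x y)) (sym su≡u′) (sym sv≡v′) (linePairs-line T q∈)))
      unscaled : ∀ {x y} → s ⊛ x ≡ y → x ≡ y
      unscaled {x} sx≡y = trans (sym (⊛-identityˡ x)) (trans (cong (_⊛ x) (sym s≡𝟏)) sx≡y)

  line⊆group : ∀ {u v} → u ≢ 𝟎 → InSubfield F m (ratio (u , v)) → Span2 u v ⊆ Grp F m u
  line⊆group {u} {v} u≢𝟎 r∈K x x∈ = on-line x∈
    where
    r = ratio (u , v)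
    v≡ur : v ≡ u ⊛ r
    v≡ur = sym (trans (cong (u ⊛_) (⊛-comm v (u ⁻¹))) (x⊛[x⁻¹⊛y]≡y v u≢𝟎))
    on-line : Span2 u v x → Grp F m u x
    on-line (inj₁ x≡𝟎)                 = 𝟎 , subfield-𝟎 m , trans x≡𝟎 (sym (⊛-zeroʳ u))
    on-line (inj₂ (inj₁ x≡u))          = 𝟏 , subfield-𝟏 m , trans x≡u (sym (⊛-identityʳ u))
    on-line (inj₂ (inj₂ (inj₁ x≡v)))   = r , r∈K , trans x≡v v≡ur
    on-line (inj₂ (inj₂ (inj₂ x≡u⊕v))) = 𝟏 ⊕ r , subfield-⊕ m (subfield-𝟏 m) r∈K , (begin
      x                      ≡⟨ x≡u⊕v ⟩
      u ⊕ v                  ≡⟨ cong₂ _⊕_ (⊛-identityʳ u) (sym v≡ur) ⟨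
      (u ⊛ 𝟏) ⊕ (u ⊛ r)      ≡⟨ ⊛-distribˡ u 𝟏 r ⟨
      u ⊛ (𝟏 ⊕ r)            ∎)
      where open ≡-Reasoning

  line⊆group⇒subfield : ∀ {a t} → Span2 𝟏 t ⊆ Grp F m a → InSubfield F m t
  line⊆group⇒subfield {a} {t} line⊆aK
    with line⊆aK 𝟏 (inj₂ (inj₁ refl)) | line⊆aK t (inj₂ (inj₂ (inj₁ refl)))
  ... | y , y∈K , 𝟏≡ay | z , z∈K , t≡az =
    subst (InSubfield F m) (sym t≡y⁻¹z) (subfield-⊛ m (subfield-⁻¹ m y≢𝟎 y∈K) z∈K)
    where
    y≢𝟎 : y ≢ 𝟎
    y≢𝟎 y≡𝟎 = 𝟏≢𝟎 (trans 𝟏≡ay (trans (cong (a ⊛_) y≡𝟎) (⊛-zeroʳ a)))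
    t≡y⁻¹z : t ≡ y ⁻¹ ⊛ z
    t≡y⁻¹z = trans t≡az (cong (_⊛ z) (⁻¹-unique (trans (⊛-comm y a) (sym 𝟏≡ay))))

  ratios-∉-subfield : ∀ {T} → B T → ∀ {z} → z ∈ ratios T → ¬ InSubfield F m z
  ratios-∉-subfield {T} BT {z} z∈ z∈K =
    [ in-no-group , in-no-block ]′ (lines-covered u v (Indep2-intro u≢𝟎 v≢𝟎 u≢v))
    where
    found = ∈-map⁻ ratio z∈
    u = proj₁ (proj₁ found)
    v = proj₂ (proj₁ found)
    uv∈ = proj₁ (proj₂ found)
    distinct = All.lookup (linePairs-nonzeroDistinct (blocks-are-triangles T BT)) uv∈
    u≢𝟎 = proj₁ distinct
    v≢𝟎 = proj₁ (proj₂ distinct)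
    u≢v = proj₂ (proj₂ distinct)
    in-no-group = λ covered →
      proj₂ covered u u≢𝟎 (line⊆group u≢𝟎 (subst (InSubfield F m) (proj₂ (proj₂ found)) z∈K))
    in-no-block = λ uncovered → proj₁ uncovered T BT (linePairs-line T uv∈)

  ∉subfield⇒≢𝟎 : ∀ {t} → ¬ InSubfield F m t → t ≢ 𝟎
  ∉subfield⇒≢𝟎 t∉K refl = t∉K (subfield-𝟎 m)

  ∉subfield⇒𝟏≢ : ∀ {t} → ¬ InSubfield F m t → 𝟏 ≢ t
  ∉subfield⇒𝟏≢ t∉K refl = t∉K (subfield-𝟏 m)

  Indep2-𝟏 : ∀ {t} → ¬ InSubfield F m t → Indep2 𝟏 t
  Indep2-𝟏 t∉K = Indep2-intro 𝟏≢𝟎 (∉subfield⇒≢𝟎 t∉K) (∉subfield⇒𝟏≢ t∉K)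

  blockThrough : ∀ {t} → ¬ InSubfield F m t → Σ (Triple n) λ T → B T × LineOf T (Span2 𝟏 t)
  blockThrough {t} t∉K with lines-covered 𝟏 t (Indep2-𝟏 t∉K)
  ... | inj₁ ((found , _) , _)           = found
  ... | inj₂ (_ , (_ , _ , line⊆aK) , _) = ⊥-elim (t∉K (line⊆group⇒subfield line⊆aK))

  ∈-ratios-blockThrough : ∀ {t} (t∉K : ¬ InSubfield F m t) → t ∈ ratios (proj₁ (blockThrough t∉K))
  ∈-ratios-blockThrough {t} t∉K with blockThrough t∉K
  ... | T , _ , line = subst (_∈ ratios T) t⊛𝟏⁻¹≡t (∈-map⁺ ratio
    (∈-linePairs T line (inj₂ (inj₁ refl)) (inj₂ (inj₂ (inj₁ refl))) 𝟏≢𝟎 (∉subfield⇒≢𝟎 t∉K) (∉subfield⇒𝟏≢ t∉K)))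
    where
    t⊛𝟏⁻¹≡t : t ⊛ 𝟏 ⁻¹ ≡ t
    t⊛𝟏⁻¹≡t = trans (cong (t ⊛_) (sym (⁻¹-unique (⊛-identityˡ 𝟏)))) (⊛-identityʳ t)

  ratios-blockThrough-≐ : ∀ {t t′} (t∉K : ¬ InSubfield F m t) (t′∉K : ¬ InSubfield F m t′) →
    t′ ∈ ratios (proj₁ (blockThrough t∉K)) → ∀ {z} →
    (z ∈ ratios (proj₁ (blockThrough t′∉K)) → z ∈ ratios (proj₁ (blockThrough t∉K))) ×
    (z ∈ ratios (proj₁ (blockThrough t∉K)) → z ∈ ratios (proj₁ (blockThrough t′∉K)))
  ratios-blockThrough-≐ t∉K t′∉K t′∈ = from-T′ , to-T′
    where
    T = proj₁ (blockThrough t∉K)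
    BT = proj₁ (proj₂ (blockThrough t∉K))
    T′ = proj₁ (blockThrough t′∉K)
    BT′ = proj₁ (proj₂ (blockThrough t′∉K))
    found = ∈-map⁻ ratio t′∈
    u = proj₁ (proj₁ found)
    v = proj₂ (proj₁ found)
    uv∈ = proj₁ (proj₂ found)
    u≢𝟎 = proj₁ (All.lookup (linePairs-nonzeroDistinct (blocks-are-triangles T BT)) uv∈)
    s≢𝟎 = ⁻¹-nonzero u≢𝟎
    T′≡u⁻¹T : TriEq T′ (scale (u ⁻¹) T)
    T′≡u⁻¹T = block-transport BT BT′ s≢𝟎 uv∈
      (subst₂ (λ p q → LineOf T′ (Span2 p q)) (sym (⊛-inverseˡ u≢𝟎))
        (trans (proj₂ (proj₂ found)) (⊛-comm v (u ⁻¹))) (proj₂ (proj₂ (blockThrough t′∉K))))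
    from-T′ : ∀ {z} → z ∈ ratios T′ → z ∈ ratios T
    from-T′ {z} z∈ = subst (z ∈_) (ratios-scale s≢𝟎 T)
      (ratios-⊑ (blocks-are-triangles T′ BT′) (proj₁ T′≡u⁻¹T) z∈)
    to-T′ : ∀ {z} → z ∈ ratios T → z ∈ ratios T′
    to-T′ {z} z∈ = ratios-⊑ (Indep3-scale s≢𝟎 (blocks-are-triangles T BT)) (proj₂ T′≡u⁻¹T)
      (subst (z ∈_) (sym (ratios-scale s≢𝟎 T)) z∈)

  nonSubfield : List (V n)
  nonSubfield = filter (∁? InSubfield?) (vectors n)

  -- The classes are only used on nonSubfield; on the subfield classOf is a junk [].
  classOf : V n → List (V n)
  classOf t with InSubfield? t
  ... | yes _   = []
  ... | no t∉K = ratios (proj₁ (blockThrough t∉K))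

  classOf-elim : ∀ {t} (P : List (V n) → Set) → t ∈ nonSubfield →
    (∀ (t∉K : ¬ InSubfield F m t) → P (ratios (proj₁ (blockThrough t∉K)))) → P (classOf t)
  classOf-elim {t} P t∈ h with InSubfield? t
  ... | yes t∈K = ⊥-elim (proj₂ (∈-filter⁻ (∁? InSubfield?) {xs = vectors n} t∈) t∈K)
  ... | no t∉K  = h t∉K

  nonSubfield-partition : IsPartition _≟ⱽ_ 18 classOf nonSubfield
  nonSubfield-partition = record
    { unique       = Uniqueₚ.filter⁺ (∁? InSubfield?) (vectors-unique n)
    ; class-unique = λ t∈ → classOf-elim Unique t∈ λ t∉K → ratios-unique (block t∉K)
    ; class-size   = λ t∈ → classOf-elim (λ C → length C ≡ 18) t∈ λ _ → refl
    ; class-self   = λ {t} t∈ → classOf-elim (t ∈_) t∈ ∈-ratios-blockThrough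
    ; class-⊆      = λ {t} {y} t∈ → classOf-elim (λ C → y ∈ C → y ∈ nonSubfield) t∈ λ t∉K y∈ →
        ∈-filter⁺ (∁? InSubfield?) (∈-vectors y) (ratios-∉-subfield (block t∉K) y∈)
    ; class-≐      = λ {t} {y} {z} t∈ → classOf-elim
        (λ C → y ∈ C → (z ∈ classOf y → z ∈ C) × (z ∈ C → z ∈ classOf y)) t∈ λ t∉K y∈ →
        classOf-elim (λ C′ → (z ∈ C′ → z ∈ _) × (z ∈ _ → z ∈ C′))
          (∈-filter⁺ (∁? InSubfield?) (∈-vectors y) (ratios-∉-subfield (block t∉K) y∈))
          λ y∉K → ratios-blockThrough-≐ t∉K y∉K y∈
    }
    where
    block : ∀ {t} (t∉K : ¬ InSubfield F m t) → B (proj₁ (blockThrough t∉K))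
    block t∉K = proj₁ (proj₂ (blockThrough t∉K))

  18∣length-nonSubfield : 18 ∣ length nonSubfield
  18∣length-nonSubfield = partition-∣ _≟ⱽ_ nonSubfield nonSubfield-partition

2^[6+d]%9≡2^d%9 : ∀ d → 2 ^ (6 + d) % 9 ≡ 2 ^ d % 9
2^[6+d]%9≡2^d%9 d = begin
  2 ^ (6 + d) % 9                 ≡⟨ cong (_% 9) (ℕ.^-distribˡ-+-* 2 6 d) ⟩
  (2 ^ d + 63 * 2 ^ d) % 9        ≡⟨ cong (λ k → (2 ^ d + k) % 9) (trans (ℕ.*-assoc 9 7 (2 ^ d)) (ℕ.*-comm 9 (7 * 2 ^ d))) ⟩
  (2 ^ d + 7 * 2 ^ d * 9) % 9     ≡⟨ [m+kn]%n≡m%n (2 ^ d) (7 * 2 ^ d) 9 ⟩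
  2 ^ d % 9                       ∎
  where open ≡-Reasoning

2^d%9≡1⇒6∣d : ∀ d → 2 ^ d % 9 ≡ 1 → 6 ∣ d
2^d%9≡1⇒6∣d 0 _ = 6 ∣0
2^d%9≡1⇒6∣d 1 ()
2^d%9≡1⇒6∣d 2 ()
2^d%9≡1⇒6∣d 3 ()
2^d%9≡1⇒6∣d 4 ()
2^d%9≡1⇒6∣d 5 ()
2^d%9≡1⇒6∣d (suc (suc (suc (suc (suc (suc d)))))) 2^[6+d]%9≡1 =
  ∣m∣n⇒∣m+n (∣-refl {6}) (2^d%9≡1⇒6∣d d (trans (sym (2^[6+d]%9≡2^d%9 d)) 2^[6+d]%9≡1))

9∣2^m*j⇒9∣j : ∀ m j → 9 ∣ 2 ^ m * j → 9 ∣ j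
9∣2^m*j⇒9∣j zero    j 9∣j+0 = subst (9 ∣_) (ℕ.+-identityʳ j) 9∣j+0
9∣2^m*j⇒9∣j (suc m) j 9∣2*2^m*j = 9∣2^m*j⇒9∣j m j
  (coprime-divisor (from-yes (coprime? 9 2)) (subst (9 ∣_) (ℕ.*-assoc 2 (2 ^ m) j) 9∣2*2^m*j))

9∣2^[m+d]-2^m⇒6∣d : ∀ m d {N} → 9 ∣ N → 2 ^ m + N ≡ 2 ^ (m + d) → 6 ∣ d
9∣2^[m+d]-2^m⇒6∣d m d {N} 9∣N 2^m+N≡2^[m+d] = 2^d%9≡1⇒6∣d d (begin
  2 ^ d % 9                 ≡⟨ cong (_% 9) (ℕ.suc-pred (2 ^ d) {{ℕ.m^n≢0 2 d}}) ⟨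
  suc j % 9                 ≡⟨ cong (λ k → suc k % 9) (proj₂ 9∣j) ⟩
  (1 + proj₁ 9∣j * 9) % 9   ≡⟨ [m+kn]%n≡m%n 1 (proj₁ 9∣j) 9 ⟩
  1                         ∎)
  where
  open ≡-Reasoning
  j = pred (2 ^ d)
  N≡2^m*j : N ≡ 2 ^ m * j
  N≡2^m*j = ℕ.+-cancelˡ-≡ (2 ^ m) N (2 ^ m * j) (begin
    2 ^ m + N                 ≡⟨ 2^m+N≡2^[m+d] ⟩
    2 ^ (m + d)               ≡⟨ ℕ.^-distribˡ-+-* 2 m d ⟩
    2 ^ m * 2 ^ d             ≡⟨ cong (2 ^ m *_) (ℕ.suc-pred (2 ^ d) {{ℕ.m^n≢0 2 d}}) ⟨
    2 ^ m * suc j             ≡⟨ ℕ.*-suc (2 ^ m) j ⟩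
    2 ^ m + 2 ^ m * j         ∎)
  9∣j : ∃ λ q → j ≡ q * 9
  9∣j with 9∣2^m*j⇒9∣j m j (subst (9 ∣_) N≡2^m*j 9∣N)
  ... | divides q j≡q*9 = q , j≡q*9

corollary1 : ∀ {n m : ℕ} → m ∣ n → (F : FieldOn n) → (B : Triple n → Set) →
    IsInvariantDesarguesianGDTD F m B → 6 ∣ (n ∸ m)
corollary1 {m = m} (divides zero refl) F B D = subst (6 ∣_) (sym (ℕ.0∸n≡0 m)) (6 ∣0)
corollary1 {m = zero} (divides (suc i) n≡[1+i]*0) F B D =
  subst (6 ∣_) (sym (trans n≡[1+i]*0 (ℕ.*-zeroʳ (suc i)))) (6 ∣0)
corollary1 {n} {m@(suc _)} (divides (suc i) n≡m+i*m) F B D =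
  subst (6 ∣_) (sym n∸m≡i*m) (9∣2^[m+d]-2^m⇒6∣d m (i * m) 9∣length-nonSubfield (begin
    2 ^ m + length nonSubfield                ≡⟨ cong (_+ length nonSubfield) (length-subfield {i} (sym n≡m+i*m)) ⟨
    length subfield + length nonSubfield      ≡⟨ length-filter-∁ InSubfield? (vectors n) ⟩
    length (vectors n)                        ≡⟨ length-vectors n ⟩
    2 ^ n                                     ≡⟨ cong (2 ^_) n≡m+i*m ⟩
    2 ^ (m + i * m)                           ∎))
  where
  open ≡-Reasoning
  open SubfieldSize F m
  open Design D
  n∸m≡i*m : n ∸ m ≡ i * m
  n∸m≡i*m = trans (cong (_∸ m) n≡m+i*m) (ℕ.m+n∸m≡n m (i * m))
  9∣length-nonSubfield : 9 ∣ length nonSubfield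
  9∣length-nonSubfield = ∣-trans (divides 2 refl) 18∣length-nonSubfield
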